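{- Let $n,c$ be positive integers and $r,h$ integers. Then $$\sum_{\substack{k\in\mathbb{Z}\\ k\equiv r\pmod{c}}}(-1)^kq^{\binom{k}{2}+hk}\begin{bmatrix} n\\ k\end{bmatrix}_{q}$$ is divisible by $\prod_{d\ge1,\ c\mid d}\Phi_d(q)^{\lfloor n/d\rfloor}$, i.e. the quotient lies in $\mathbb{Z}[q,q^{ -1}]$.
   Context: $[m]_q=\frac{1-q^m}{1-q}$; for integers $n$ and $k>0$, $\begin{bmatrix} n\\ k\end{bmatrix}_q=\frac{[n]_q[n-1]_q\cdots[n-k+1]_q}{[k]_q\cdots[1]_q}$, $\begin{bmatrix} n\\ 0\end{bmatrix}_q=1$ and $\begin{bmatrix} n\\ k\end{bmatrix}_q=0$ for $k<0$. $\Phi_d$ is the $d$-th cyclotomic polynomial (the product is finite since exponents vanish for $d>n$). -}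

module Defs where

open import Data.Nat as ℕ using (ℕ; zero; suc; _∸_; _/_)
open import Data.Nat.Divisibility using (_∣?_)
open import Data.Nat.Combinatorics using (_C_)
open import Data.Integer as ℤ using (ℤ; +_; -[1+_]; 0ℤ; 1ℤ; ∣_∣)
open import Data.List using (List; []; _∷_; replicate; foldr; map; upTo; filter; _++_)
open import Data.Product using (Σ)
open import Relation.Binary.PropositionalEquality using (_≡_)

-- Polynomials in ℤ[q]: coefficient lists, lowest degree first.

Poly : Set
Poly = List ℤ

coeff : Poly → ℕ → ℤ
coeff []      _       = 0ℤ
coeff (a ∷ p) zero    = a
coeff (a ∷ p) (suc i) = coeff p i

-- equality of polynomials (coefficientwise; trailing zeros irrelevant)
_≈P_ : Poly → Poly → Set
p ≈P r = ∀ i → coeff p i ≡ coeff r i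

infixl 6 _+P_ _-P_
infixl 7 _*P_

_+P_ : Poly → Poly → Poly
[]      +P r       = r
(a ∷ p) +P []      = a ∷ p
(a ∷ p) +P (b ∷ r) = (a ℤ.+ b) ∷ (p +P r)

scaleP : ℤ → Poly → Poly
scaleP a = map (a ℤ.*_)

_-P_ : Poly → Poly → Poly
p -P r = p +P scaleP (ℤ.- 1ℤ) r

_*P_ : Poly → Poly → Poly
[]      *P r = []
(a ∷ p) *P r = scaleP a r +P (0ℤ ∷ (p *P r))

oneP : Poly
oneP = 1ℤ ∷ []

X^ : ℕ → Poly
X^ m = replicate m 0ℤ ++ oneP

prodP : List Poly → Poly
prodP = foldr _*P_ oneP

_^P_ : Poly → ℕ → Poly
p ^P zero  = oneP
p ^P suc m = p *P (p ^P m)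

qint : ℕ → Poly
qint m = replicate m 1ℤ

-- Laurent polynomials ℤ[q,q⁻¹]:  num /q^ den  denotes  num · q^(-den).

record Laurent : Set where
  constructor _/q^_
  field
    num : Poly
    den : ℕ

_≈L_ : Laurent → Laurent → Set
(p /q^ m) ≈L (r /q^ m') = (X^ m' *P p) ≈P (X^ m *P r)

_+L_ : Laurent → Laurent → Laurent
(p /q^ m) +L (r /q^ m') = (X^ m' *P p +P X^ m *P r) /q^ (m ℕ.+ m')

_*L_ : Laurent → Laurent → Laurent
(p /q^ m) *L (r /q^ m') = (p *P r) /q^ (m ℕ.+ m')

zeroL : Laurent
zeroL = [] /q^ 0

fromPoly : Poly → Laurent
fromPoly p = p /q^ 0

monoL : ℤ → ℤ → Laurent
monoL a (+ m)      = scaleP a (X^ m) /q^ 0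
monoL a -[1+ m ]   = (a ∷ []) /q^ suc m

_∣L_ : Laurent → Laurent → Set
A ∣L B = Σ Laurent (λ C → (A *L C) ≈L B)

sumL : List Laurent → Laurent
sumL = foldr _+L_ zeroL

-- Cyclotomic polynomials, characterised by  q^d - 1 = ∏_{e ∣ d} Φ_e(q)
-- for all d ≥ 1 (this determines Φ_d for every d ≥ 1 uniquely).

IsCyclotomicFamily : (ℕ → Poly) → Set
IsCyclotomicFamily Φ =
  ∀ d → 1 ℕ.≤ d →
    prodP (map Φ (filter (λ e → e ∣? d) (map suc (upTo d)))) ≈P (X^ d -P oneP)

-- Gaussian binomials [n k]_q for 0 ≤ k ≤ n, defined as the quotient
--   [n]_q [n-1]_q ⋯ [n-k+1]_q / ([k]_q ⋯ [1]_q).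
IsGaussianFamily : ℕ → (ℕ → Poly) → Set
IsGaussianFamily n B =
  ∀ k → k ℕ.≤ n →
    (B k *P prodP (map (λ i → qint (suc i)) (upTo k)))
      ≈P prodP (map (λ i → qint (n ∸ i)) (upTo k))

sgn : ℕ → ℤ
sgn zero    = 1ℤ
sgn (suc k) = ℤ.- sgn k

-- the sum  Σ_{k ≡ r (mod c)} (-1)^k q^(C(k,2)+hk) [n k]_q ; terms with
-- k < 0 or k > n vanish, so k ranges over 0..n.
-- k ≡ r (mod c)  is  c ∣ |k - r|.
theSum : (n c : ℕ) → (r h : ℤ) → (ℕ → Poly) → Laurent
theSum n c r h B =
  sumL (map (λ k → monoL (sgn k) ((+ (k C 2)) ℤ.+ h ℤ.* (+ k)) *L fromPoly (B k))
            (filter (λ k → c ∣? ∣ (+ k) ℤ.- r ∣) (upTo (suc n))))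

-- ∏_{d ≥ 1, c ∣ d} Φ_d(q)^⌊n/d⌋  (factors with d > n are 1)
cycProd : (ℕ → Poly) → (n c : ℕ) → Poly
cycProd Φ n c =
  prodP (map (λ i → Φ (suc i) ^P (n / suc i))
             (filter (λ i → c ∣? suc i) (upTo n)))

-- Write the sum as the multisection, over k ≡ r (mod c), of the q-binomial expansion
-- (y; q)_n = ∑_k (-1)^k q^C(k,2) [n k]_q y^k at y = q^h.  Fix d with c ∣ d.  Splitting
-- (y; q)_n = (y; q)_d (yq^d; q)_{n-d} writes the multisection for n as a combination of
-- multisections for n - d: the inner coefficients [d j]_q (0 < j < d) are divisible by Φ_d(q),
-- and the two outer ones combine, by periodicity in r, into 1 + (-1)^d q^C(d,2) y^d, which
-- Φ_d(q) divides because y^d ≡ 1 and (-1)^d q^C(d,2) ≡ -1 modulo Φ_d(q).  Induction gives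
-- Φ_d(q)^⌊n/d⌋.  These powers are pairwise coprime over ℚ and have constant term ±1, so their
-- product still divides the sum in ℤ[q,q⁻¹].
module Submission where

open import Defs
open import Level using (0ℓ)
open import Data.Nat as ℕ using (ℕ; zero; suc; _<_; _≤_; z≤n; s≤s; _∸_; _/_)
import Data.Nat.Properties as ℕP
import Data.Nat.DivMod as ℕDM
open import Data.Integer as ℤ using (ℤ; +_; -[1+_]; 0ℤ; 1ℤ; ∣_∣)
import Data.Integer.Properties as ℤP
import Data.Integer.Divisibility.Signed as ZS
open import Data.List using (List; []; _∷_; _++_; foldr; map; filter; upTo)
import Data.List.Properties as LP
open import Relation.Unary using (Pred; Decidable)
open import Data.List.Membership.Propositional using (_∈_)
open import Data.List.Relation.Unary.Any using (here; there)
open import Data.List.Membership.Propositional.Properties using (∈-map⁺; ∈-filter⁺; ∈-upTo⁺)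
open import Data.Nat.Combinatorics using (_C_; nCk+nC[k+1]≡[n+1]C[k+1]; nC1≡n)
open import Data.Nat.GCD using (gcd; gcd[m,n]∣m; gcd[m,n]∣n; gcd[m,n]≢0; gcd-GCD; module Bézout)
open import Data.Empty using (⊥-elim)
open import Data.Product using (Σ; _,_; proj₁; proj₂; _×_)
open import Data.Sum using (_⊎_; inj₁; inj₂; [_,_]′)
open import Relation.Binary.PropositionalEquality as ≡ using (_≡_; _≢_; refl)
open import Algebra.Bundles using (Monoid; CommutativeRing; RawRing)
open import Algebra.Solver.Ring.AlmostCommutativeRing
  using (fromCommutativeRing; _-Raw-AlmostCommutative⟶_)
open import Data.Maybe using (Maybe; just; nothing)
open import Relation.Nullary using (yes; no; does; ¬_)
open import Relation.Nullary.Decidable using (does-⇔; dec-true; dec-false)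
open import Function using (mk⇔)
open import Data.Bool using (Bool; true; false; if_then_else_; _∧_; not)
open import Data.Nat.Divisibility as ℕD using (_∣?_)
open import Data.Integer.Tactic.RingSolver using (solve-∀)
open import Data.Nat.Tactic.RingSolver using () renaming (solve-∀ to ℕ-solve-∀)

ℤ-rawRing : RawRing 0ℓ 0ℓ
ℤ-rawRing = CommutativeRing.rawRing ℤP.+-*-commutativeRing

-- The ring map ℤ → R, taken as data so that the ring solver can use integer coefficients.
ℤ-Algebra : CommutativeRing 0ℓ 0ℓ → Set
ℤ-Algebra R = ℤ-rawRing -Raw-AlmostCommutative⟶ fromCommutativeRing R

module ℤ-Solver (R : CommutativeRing 0ℓ 0ℓ) (ι : ℤ-Algebra R) where
  open CommutativeRing R using (_≈_) renaming (refl to ≈-refl)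
  open _-Raw-AlmostCommutative⟶_ ι using (⟦_⟧)

  weakly-decide : ∀ a b → Maybe (⟦ a ⟧ ≈ ⟦ b ⟧)
  weakly-decide a b with a ℤP.≟ b
  ... | yes refl = just ≈-refl
  ... | no _     = nothing

  open import Algebra.Solver.Ring ℤ-rawRing (fromCommutativeRing R) ι weakly-decide public

module MonoidFolds (M : Monoid 0ℓ 0ℓ) where
  open Monoid M renaming (refl to ≈-refl; sym to ≈-sym; trans to ≈-trans)

  ⨁ : ℕ → (ℕ → Carrier) → Carrier
  ⨁ zero    f = ε
  ⨁ (suc n) f = ⨁ n f ∙ f n

  ⨁-cong : ∀ n {f g} → (∀ k → k < n → f k ≈ g k) → ⨁ n f ≈ ⨁ n g
  ⨁-cong zero    f≈g = ≈-refl
  ⨁-cong (suc n) f≈g = ∙-cong (⨁-cong n (λ k k<n → f≈g k (ℕP.m<n⇒m<1+n k<n))) (f≈g n ℕP.≤-refl)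

  ⨁-lower-index : ∀ n f → ⨁ (suc n) f ≈ f 0 ∙ ⨁ n (λ k → f (suc k))
  ⨁-lower-index zero    f = ≈-trans (identityˡ (f 0)) (≈-sym (identityʳ (f 0)))
  ⨁-lower-index (suc n) f = ≈-trans (∙-congʳ (⨁-lower-index n f)) (assoc (f 0) _ _)

  foldr-++ : ∀ xs ys → foldr _∙_ ε (xs ++ ys) ≈ foldr _∙_ ε xs ∙ foldr _∙_ ε ys
  foldr-++ []       ys = ≈-sym (identityˡ _)
  foldr-++ (x ∷ xs) ys = ≈-trans (∙-congˡ (foldr-++ xs ys)) (≈-sym (assoc _ _ _))

  foldr-upTo : ∀ (f : ℕ → Carrier) n → foldr _∙_ ε (map f (upTo n)) ≈ ⨁ n f
  foldr-upTo f zero    = ≈-refl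
  foldr-upTo f (suc n) = begin
    foldr _∙_ ε (map f (upTo (suc n)))         ≡⟨ ≡.cong (λ xs → foldr _∙_ ε (map f xs)) (LP.upTo-∷ʳ n) ⟨
    foldr _∙_ ε (map f (upTo n ++ n ∷ []))     ≡⟨ ≡.cong (foldr _∙_ ε) (LP.map-++ f (upTo n) (n ∷ [])) ⟩
    foldr _∙_ ε (map f (upTo n) ++ f n ∷ [])   ≈⟨ foldr-++ (map f (upTo n)) (f n ∷ []) ⟩
    foldr _∙_ ε (map f (upTo n)) ∙ (f n ∙ ε)   ≈⟨ ∙-cong (foldr-upTo f n) (identityʳ (f n)) ⟩
    ⨁ (suc n) f                                ∎
    where open import Relation.Binary.Reasoning.Setoid setoid

  foldr-filter-upTo : ∀ (f : ℕ → Carrier) (s : ℕ → ℕ) {P : Pred ℕ 0ℓ} (P? : Decidable P) n →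
    foldr _∙_ ε (map f (filter P? (map s (upTo n)))) ≈ ⨁ n (λ i → if does (P? (s i)) then f (s i) else ε)
  foldr-filter-upTo f s P? zero    = ≈-refl
  foldr-filter-upTo f s P? (suc n) = begin
    foldr _∙_ ε (map f (filter P? (map s (upTo (suc n)))))
      ≡⟨ ≡.cong (λ xs → foldr _∙_ ε (map f (filter P? (map s xs)))) (LP.upTo-∷ʳ n) ⟨
    foldr _∙_ ε (map f (filter P? (map s (upTo n ++ n ∷ []))))
      ≡⟨ ≡.cong (λ xs → foldr _∙_ ε (map f (filter P? xs))) (LP.map-++ s (upTo n) (n ∷ [])) ⟩
    foldr _∙_ ε (map f (filter P? (map s (upTo n) ++ s n ∷ [])))
      ≡⟨ ≡.cong (λ xs → foldr _∙_ ε (map f xs)) (LP.filter-++ P? (map s (upTo n)) (s n ∷ [])) ⟩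
    foldr _∙_ ε (map f (filter P? (map s (upTo n)) ++ filter P? (s n ∷ [])))
      ≡⟨ ≡.cong (foldr _∙_ ε) (LP.map-++ f (filter P? (map s (upTo n))) _) ⟩
    foldr _∙_ ε (map f (filter P? (map s (upTo n))) ++ map f (filter P? (s n ∷ [])))
      ≈⟨ foldr-++ (map f (filter P? (map s (upTo n)))) _ ⟩
    foldr _∙_ ε (map f (filter P? (map s (upTo n)))) ∙ foldr _∙_ ε (map f (filter P? (s n ∷ [])))
      ≈⟨ ∙-cong (foldr-filter-upTo f s P? n) last ⟩
    ⨁ (suc n) (λ i → if does (P? (s i)) then f (s i) else ε) ∎
    where
    open import Relation.Binary.Reasoning.Setoid setoid
    last : foldr _∙_ ε (map f (filter P? (s n ∷ []))) ≈ (if does (P? (s n)) then f (s n) else ε)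
    last with P? (s n)
    ... | yes _ = identityʳ (f (s n))
    ... | no  _ = ≈-refl

module CommutativeRingFacts (R : CommutativeRing 0ℓ 0ℓ) (ι : ℤ-Algebra R) where
  open CommutativeRing R public renaming (refl to ≈-refl; sym to ≈-sym; trans to ≈-trans)
  open import Algebra.Properties.Ring ring public using (-‿distribˡ-*; -1*x≈-x)
  open import Algebra.Properties.Group +-group using (⁻¹-involutive)
  open import Algebra.Properties.CommutativeSemiring.Exp commutativeSemiring public
  open import Algebra.Properties.Semiring.Divisibility semiring public
    using (_∣_; _,_; ∣ʳ-refl; ∣ʳ-respˡ-≈; ∣ʳ-respʳ-≈; ε∣ʳ_; _∣0; x∣ʳy⇒x∣ʳzy)
  open import Relation.Binary.Reasoning.Setoid setoid public
  open ℤ-Solver R ι public using (solve; _:+_; _:*_; _:-_; :-_; _:=_)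
  open MonoidFolds +-monoid public
    using () renaming (⨁ to ∑; ⨁-cong to ∑-cong; ⨁-lower-index to ∑-lower-index; foldr-filter-upTo to sum-filter-upTo)
  open MonoidFolds *-monoid public
    using () renaming (⨁ to ∏; ⨁-cong to ∏-cong; foldr-upTo to product-upTo; foldr-filter-upTo to product-filter-upTo)
  open _-Raw-AlmostCommutative⟶_ ι public using (⟦_⟧)
    renaming (0-homo to ⟦0⟧≈0; 1-homo to ⟦1⟧≈1; +-homo to ⟦+⟧≈+; *-homo to ⟦*⟧≈*; -‿homo to ⟦-⟧≈-)

  -0≈0 : - 0# ≈ 0#
  -0≈0 = ≈-trans (≈-sym (+-identityˡ (- 0#))) (-‿inverseʳ 0#)

  x-0≈x : ∀ x → x - 0# ≈ x
  x-0≈x x = ≈-trans (+-congˡ -0≈0) (+-identityʳ x)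

  -1*-1≈1 : - 1# * - 1# ≈ 1#
  -1*-1≈1 = ≈-trans (-1*x≈-x (- 1#)) (⁻¹-involutive 1#)

  1^n≈1 : ∀ n → 1# ^ n ≈ 1#
  1^n≈1 zero    = ≈-refl
  1^n≈1 (suc n) = ≈-trans (*-identityˡ _) (1^n≈1 n)

  ^-swap : ∀ x m n → (x ^ m) ^ n ≈ (x ^ n) ^ m
  ^-swap x m n = ≈-trans (^-assocʳ x m n)
                   (≈-trans (^-congʳ x (ℕP.*-comm m n)) (≈-sym (^-assocʳ x n m)))

  ∣x∣y⇒∣x+y : ∀ {a x y} → a ∣ x → a ∣ y → a ∣ x + y
  ∣x∣y⇒∣x+y {a} (k , ka≈x) (l , la≈y) = k + l , ≈-trans (distribʳ a k l) (+-cong ka≈x la≈y)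

  ∣x⇒∣-x : ∀ {a x} → a ∣ x → a ∣ - x
  ∣x⇒∣-x {a} (k , ka≈x) = - k , ≈-trans (≈-sym (-‿distribˡ-* k a)) (-‿cong ka≈x)

  ∣x⇒∣x*y : ∀ {a x} y → a ∣ x → a ∣ x * y
  ∣x⇒∣x*y {x = x} y a∣x = ∣ʳ-respʳ-≈ (*-comm y x) (x∣ʳy⇒x∣ʳzy y a∣x)

  *-pres-∣ : ∀ {a x b y} → a ∣ x → b ∣ y → a * b ∣ x * y
  *-pres-∣ {a} {x} {b} {y} (k , ka≈x) (l , lb≈y) = k * l , ≈-trans
    (solve 4 (λ K L A B → K :* L :* (A :* B) := (K :* A) :* (L :* B)) ≈-refl k l a b)
    (*-cong ka≈x lb≈y)

  infix 4 _≡_mod_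
  _≡_mod_ : Carrier → Carrier → Carrier → Set
  x ≡ y mod a = a ∣ x - y

  ≈⇒≡mod : ∀ {a x y} → x ≈ y → x ≡ y mod a
  ≈⇒≡mod {a} {x} {y} x≈y = ∣ʳ-respʳ-≈ (≈-sym (≈-trans (+-congʳ x≈y) (-‿inverseʳ y))) (a ∣0)

  ≡mod-sym : ∀ {a x y} → x ≡ y mod a → y ≡ x mod a
  ≡mod-sym {a} {x} {y} x≡y =
    ∣ʳ-respʳ-≈ (solve 2 (λ X Y → :- (X :- Y) := Y :- X) ≈-refl x y) (∣x⇒∣-x x≡y)

  ≡mod-trans : ∀ {a x y z} → x ≡ y mod a → y ≡ z mod a → x ≡ z mod a
  ≡mod-trans {a} {x} {y} {z} x≡y y≡z =
    ∣ʳ-respʳ-≈ (solve 3 (λ X Y Z → (X :- Y) :+ (Y :- Z) := X :- Z) ≈-refl x y z) (∣x∣y⇒∣x+y x≡y y≡z)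

  +-cong-mod : ∀ {a x y x' y'} → x ≡ x' mod a → y ≡ y' mod a → x + y ≡ x' + y' mod a
  +-cong-mod {a} {x} {y} {x'} {y'} x≡x' y≡y' = ∣ʳ-respʳ-≈
    (solve 4 (λ X Y X' Y' → (X :- X') :+ (Y :- Y') := (X :+ Y) :- (X' :+ Y')) ≈-refl x y x' y')
    (∣x∣y⇒∣x+y x≡x' y≡y')

  *-cong-mod : ∀ {a x y x' y'} → x ≡ x' mod a → y ≡ y' mod a → x * y ≡ x' * y' mod a
  *-cong-mod {a} {x} {y} {x'} {y'} x≡x' y≡y' = ∣ʳ-respʳ-≈
    (solve 4 (λ X Y X' Y' → (X :- X') :* Y :+ X' :* (Y :- Y') := (X :* Y) :- (X' :* Y')) ≈-refl x y x' y')
    (∣x∣y⇒∣x+y (∣x⇒∣x*y y x≡x') (x∣ʳy⇒x∣ʳzy x' y≡y'))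

  ^-cong-mod : ∀ {a x y} n → x ≡ y mod a → x ^ n ≡ y ^ n mod a
  ^-cong-mod zero    x≡y = ≈⇒≡mod ≈-refl
  ^-cong-mod (suc n) x≡y = *-cong-mod x≡y (^-cong-mod n x≡y)

  ^-≡1-mod : ∀ {a x} n → x ≡ 1# mod a → x ^ n ≡ 1# mod a
  ^-≡1-mod n x≡1 = ≡mod-trans (^-cong-mod n x≡1) (≈⇒≡mod (1^n≈1 n))

  ≡0mod⇒∣ : ∀ {a x} → x ≡ 0# mod a → a ∣ x
  ≡0mod⇒∣ {x = x} x≡0 = ∣ʳ-respʳ-≈ (x-0≈x x) x≡0

  ∑-last-zero : ∀ n f → f n ≈ 0# → ∑ (suc n) f ≈ ∑ n f
  ∑-last-zero n f fn≈0 = ≈-trans (+-congˡ fn≈0) (+-identityʳ _)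

  ∑-minus-scaled : ∀ n f a g → ∑ n (λ k → f k - a * g k) ≈ ∑ n f - a * ∑ n g
  ∑-minus-scaled zero    f a g =
    ≈-sym (≈-trans (+-congˡ (≈-trans (-‿cong (zeroʳ a)) -0≈0)) (+-identityʳ 0#))
  ∑-minus-scaled (suc n) f a g = ≈-trans (+-congʳ (∑-minus-scaled n f a g))
    (solve 5 (λ F A G X Y → (F :- A :* G) :+ (X :- A :* Y) := (F :+ X) :- A :* (G :+ Y)) ≈-refl
           (∑ n f) a (∑ n g) (f n) (g n))

  ∣-∑ : ∀ n {a} f → (∀ k → k < n → a ∣ f k) → a ∣ ∑ n f
  ∣-∑ zero    f a∣f = _ ∣0
  ∣-∑ (suc n) f a∣f = ∣x∣y⇒∣x+y (∣-∑ n f (λ k k<n → a∣f k (ℕP.m<n⇒m<1+n k<n))) (a∣f n ℕP.≤-refl)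

  geometric : Carrier → ℕ → Carrier
  geometric x k = ∑ k (x ^_)

  [x-1]*geometric : ∀ x k → (x - 1#) * geometric x k ≈ x ^ k - 1#
  [x-1]*geometric x zero    = ≈-trans (zeroʳ _) (≈-sym (-‿inverseʳ 1#))
  [x-1]*geometric x (suc k) = begin
    (x - 1#) * (geometric x k + x ^ k)
      ≈⟨ solve 4 (λ X O Gk Xk → (X :- O) :* (Gk :+ Xk) := (X :- O) :* Gk :+ (X :* Xk :- O :* Xk)) ≈-refl
               x 1# (geometric x k) (x ^ k) ⟩
    (x - 1#) * geometric x k + (x * x ^ k - 1# * x ^ k)
      ≈⟨ +-cong ([x-1]*geometric x k) (+-congˡ (-‿cong (*-identityˡ _))) ⟩
    (x ^ k - 1#) + (x * x ^ k - x ^ k)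
      ≈⟨ solve 3 (λ X O Xk → (Xk :- O) :+ (X :* Xk :- Xk) := X :* Xk :- O) ≈-refl x 1# (x ^ k) ⟩
    x * x ^ k - 1# ∎

  geometric≈k+[x-1]*∑geometric : ∀ x k → geometric x k ≈ ⟦ + k ⟧ + (x - 1#) * ∑ k (geometric x)
  geometric≈k+[x-1]*∑geometric x zero    = ≈-sym (≈-trans (+-cong ⟦0⟧≈0 (zeroʳ _)) (+-identityˡ 0#))
  geometric≈k+[x-1]*∑geometric x (suc k) = begin
    geometric x k + x ^ k
      ≈⟨ +-cong (geometric≈k+[x-1]*∑geometric x k) (solve 2 (λ Y O → Y := O :+ (Y :- O)) ≈-refl (x ^ k) 1#) ⟩
    (⟦ + k ⟧ + (x - 1#) * H) + (1# + (x ^ k - 1#))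
      ≈⟨ +-congˡ (+-cong (≈-sym ⟦1⟧≈1) (≈-sym ([x-1]*geometric x k))) ⟩
    (⟦ + k ⟧ + (x - 1#) * H) + (⟦ 1ℤ ⟧ + (x - 1#) * geometric x k)
      ≈⟨ solve 5 (λ K Y Hk I Gk → (K :+ Y :* Hk) :+ (I :+ Y :* Gk) := (K :+ I) :+ Y :* (Hk :+ Gk)) ≈-refl
               ⟦ + k ⟧ (x - 1#) H ⟦ 1ℤ ⟧ (geometric x k) ⟩
    (⟦ + k ⟧ + ⟦ 1ℤ ⟧) + (x - 1#) * (H + geometric x k)
      ≈⟨ +-congʳ (≈-sym (≈-trans (reflexive (≡.cong (λ z → ⟦ + z ⟧) (ℕP.+-comm 1 k))) (⟦+⟧≈+ (+ k) 1ℤ))) ⟩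
    ⟦ + suc k ⟧ + (x - 1#) * ∑ (suc k) (geometric x) ∎
    where
    H : Carrier
    H = ∑ k (geometric x)

  filteredProduct : ℕ → (ℕ → Bool) → (ℕ → Carrier) → Carrier
  filteredProduct n P g = ∏ n (λ i → if P (suc i) then g (suc i) else 1#)

  filteredProduct-cong : ∀ n (P Q : ℕ → Bool) g → (∀ e → 1 ≤ e → e ≤ n → P e ≡ Q e) →
                         filteredProduct n P g ≈ filteredProduct n Q g
  filteredProduct-cong zero    P Q g P≡Q = ≈-refl
  filteredProduct-cong (suc n) P Q g P≡Q = *-cong
    (filteredProduct-cong n P Q g λ e 1≤e e≤n → P≡Q e 1≤e (ℕP.m≤n⇒m≤1+n e≤n))
    (reflexive (≡.cong (λ b → if b then g (suc n) else 1#) (P≡Q (suc n) (s≤s z≤n) ℕP.≤-refl)))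

  filteredProduct-truncate : ∀ m n P g → m ≤ n → (∀ e → m < e → e ≤ n → P e ≡ false) →
                             filteredProduct n P g ≈ filteredProduct m P g
  filteredProduct-truncate m zero    P g z≤n    _       = ≈-refl
  filteredProduct-truncate m (suc n) P g m≤1+n P≡false with ℕP.m≤n⇒m<n∨m≡n m≤1+n
  ... | inj₂ refl      = ≈-refl
  ... | inj₁ (s≤s m≤n) = ≈-trans
    (*-cong (filteredProduct-truncate m n P g m≤n λ e m<e e≤n → P≡false e m<e (ℕP.m≤n⇒m≤1+n e≤n))
            (reflexive (≡.cong (λ b → if b then g (suc n) else 1#) (P≡false (suc n) (s≤s m≤n) ℕP.≤-refl))))
    (*-identityʳ _)

  filteredProduct-split : ∀ n (P Q : ℕ → Bool) g → filteredProduct n P g ≈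
    filteredProduct n (λ e → P e ∧ Q e) g * filteredProduct n (λ e → P e ∧ not (Q e)) g
  filteredProduct-split zero    P Q g = ≈-sym (*-identityˡ 1#)
  filteredProduct-split (suc n) P Q g = ≈-trans
    (*-cong (filteredProduct-split n P Q g) (factor-split (P (suc n)) (Q (suc n))))
    (solve 4 (λ A B C D → A :* B :* (C :* D) := A :* C :* (B :* D)) ≈-refl
           (filteredProduct n (λ e → P e ∧ Q e) g) (filteredProduct n (λ e → P e ∧ not (Q e)) g) _ _)
    where
    x : Carrier
    x = g (suc n)
    factor-split : ∀ b c → (if b then x else 1#) ≈ (if b ∧ c then x else 1#) * (if b ∧ not c then x else 1#)
    factor-split true  true  = ≈-sym (*-identityʳ x)
    factor-split true  false = ≈-sym (*-identityˡ x)
    factor-split false c     = ≈-sym (*-identityˡ 1#)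

  ∣-filteredProduct : ∀ n P g e → 1 ≤ e → e ≤ n → P e ≡ true → g e ∣ filteredProduct n P g
  ∣-filteredProduct zero    P g .0 () z≤n Pe
  ∣-filteredProduct (suc n) P g e 1≤e e≤1+n Pe with ℕP.m≤n⇒m<n∨m≡n e≤1+n
  ... | inj₂ refl      = x∣ʳy⇒x∣ʳzy _ (≡.subst (λ b → g e ∣ (if b then g e else 1#)) (≡.sym Pe) ∣ʳ-refl)
  ... | inj₁ (s≤s e≤n) = ∣x⇒∣x*y _ (∣-filteredProduct n P g e 1≤e e≤n Pe)

  filteredProduct-closed : ∀ (Q : Carrier → Set) → Q 1# → (∀ {a b} → Q a → Q b → Q (a * b)) →
    ∀ n P g → (∀ e → 1 ≤ e → e ≤ n → P e ≡ true → Q (g e)) → Q (filteredProduct n P g)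
  filteredProduct-closed Q Q1 Q* zero    P g Qg = Q1
  filteredProduct-closed Q Q1 Q* (suc n) P g Qg =
    Q* (filteredProduct-closed Q Q1 Q* n P g λ e 1≤e e≤n → Qg e 1≤e (ℕP.m≤n⇒m≤1+n e≤n)) (Q-last (P (suc n)) refl)
    where
    Q-last : ∀ b → P (suc n) ≡ b → Q (if b then g (suc n) else 1#)
    Q-last true  P≡true = Qg (suc n) (s≤s z≤n) ℕP.≤-refl P≡true
    Q-last false _      = Q1

  module UnitPowers {u u⁻¹ : Carrier} (u*u⁻¹≈1 : u * u⁻¹ ≈ 1#) where

    pow : ℤ → Carrier
    pow (+ m)      = u ^ m
    pow -[1+ m ]   = u⁻¹ ^ suc m

    u⁻¹*u≈1 : u⁻¹ * u ≈ 1#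
    u⁻¹*u≈1 = ≈-trans (*-comm u⁻¹ u) u*u⁻¹≈1

    pow-suc : ∀ w → pow (1ℤ ℤ.+ w) ≈ u * pow w
    pow-suc (+ m)          = ≈-refl
    pow-suc -[1+ zero ]    = ≈-sym (≈-trans (*-congˡ (*-identityʳ u⁻¹)) u*u⁻¹≈1)
    pow-suc -[1+ suc m ]   = ≈-sym (≈-trans (≈-sym (*-assoc u u⁻¹ _)) (≈-trans (*-congʳ u*u⁻¹≈1) (*-identityˡ _)))

    pow-pred : ∀ w → pow (ℤ.- 1ℤ ℤ.+ w) ≈ u⁻¹ * pow w
    pow-pred w = ≈-sym (begin
      u⁻¹ * pow w                              ≡⟨ ≡.cong (λ z → u⁻¹ * pow z) (cancel w) ⟩
      u⁻¹ * pow (1ℤ ℤ.+ (ℤ.- 1ℤ ℤ.+ w))        ≈⟨ *-congˡ (pow-suc (ℤ.- 1ℤ ℤ.+ w)) ⟩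
      u⁻¹ * (u * pow (ℤ.- 1ℤ ℤ.+ w))           ≈⟨ *-assoc _ _ _ ⟨
      (u⁻¹ * u) * pow (ℤ.- 1ℤ ℤ.+ w)           ≈⟨ ≈-trans (*-congʳ u⁻¹*u≈1) (*-identityˡ _) ⟩
      pow (ℤ.- 1ℤ ℤ.+ w)                       ∎)
      where cancel : ∀ w → w ≡ 1ℤ ℤ.+ (ℤ.- 1ℤ ℤ.+ w)
            cancel = solve-∀

    pow-+ : ∀ z w → pow (z ℤ.+ w) ≈ pow z * pow w
    pow-+ (+ zero)       w = ≡.subst (λ x → pow x ≈ 1# * pow w) (≡.sym (ℤP.+-identityˡ w)) (≈-sym (*-identityˡ _))
    pow-+ (+ suc m)      w = ≡.subst (λ x → pow x ≈ u ^ suc m * pow w) (≡.sym (ℤP.+-assoc 1ℤ (+ m) w))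
      (≈-trans (pow-suc (+ m ℤ.+ w)) (≈-trans (*-congˡ (pow-+ (+ m) w)) (≈-sym (*-assoc _ _ _))))
    pow-+ -[1+ zero ]    w = ≈-trans (pow-pred w) (*-congʳ (≈-sym (*-identityʳ u⁻¹)))
    pow-+ -[1+ suc m ]   w = ≡.subst (λ x → pow x ≈ pow -[1+ suc m ] * pow w) (≡.sym (ℤP.+-assoc (ℤ.- 1ℤ) -[1+ m ] w))
      (≈-trans (pow-pred (-[1+ m ] ℤ.+ w)) (≈-trans (*-congˡ (pow-+ -[1+ m ] w)) (≈-sym (*-assoc _ _ _))))

    pow-* : ∀ h k → pow (h ℤ.* + k) ≈ pow h ^ k
    pow-* h zero    = ≡.subst (λ x → pow x ≈ 1#) (≡.sym (ℤP.*-zeroʳ h)) ≈-refl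
    pow-* h (suc k) = ≡.subst (λ x → pow x ≈ pow h ^ suc k) (≡.sym (expand h (+ k)))
      (≈-trans (pow-+ h (h ℤ.* + k)) (*-congˡ (pow-* h k)))
      where expand : ∀ h x → h ℤ.* (1ℤ ℤ.+ x) ≡ h ℤ.+ h ℤ.* x
            expand = solve-∀

    pow^d≡1 : ∀ {φ} d → u ^ d ≡ 1# mod φ → ∀ h → pow h ^ d ≡ 1# mod φ
    pow^d≡1 d u^d≡1 (+ m)    = ≡mod-trans (≈⇒≡mod (^-swap u m d)) (^-≡1-mod m u^d≡1)
    pow^d≡1 d u^d≡1 -[1+ m ] = ≡mod-trans (≈⇒≡mod (^-swap u⁻¹ (suc m) d)) (^-≡1-mod (suc m) u⁻¹^d≡1)
      where
      u⁻¹^d≡1 : u⁻¹ ^ d ≡ 1# mod _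
      u⁻¹^d≡1 = ≡mod-trans (≈⇒≡mod (≈-sym (*-identityʳ (u⁻¹ ^ d))))
        (≡mod-trans (*-cong-mod (≈⇒≡mod ≈-refl) (≡mod-sym u^d≡1))
          (≈⇒≡mod (≈-trans (≈-sym (^-distrib-* u⁻¹ u d)) (≈-trans (^-congˡ d u⁻¹*u≈1) (1^n≈1 d)))))

_≡ᵇ_mod_ : ℕ → ℤ → ℕ → Bool
k ≡ᵇ r mod c = does (c ∣? ∣ + k ℤ.- r ∣)

≡ᵇ-mod-suc : ∀ c r k → suc k ≡ᵇ r mod c ≡ k ≡ᵇ r ℤ.- 1ℤ mod c
≡ᵇ-mod-suc c r k = ≡.cong (λ z → does (c ∣? ∣ z ∣)) (shift (+ k) r)
  where shift : ∀ x r → (1ℤ ℤ.+ x) ℤ.- r ≡ x ℤ.- (r ℤ.- 1ℤ)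
        shift = solve-∀

≡ᵇ-mod-periodic : ∀ c d r k → c ℕD.∣ d → k ≡ᵇ r ℤ.- + d mod c ≡ k ≡ᵇ r mod c
≡ᵇ-mod-periodic c d r k c∣d = does-⇔ (mk⇔ to from) (c ∣? _) (c ∣? _)
  where
  regroup : ∀ x r d → x ℤ.- (r ℤ.- d) ≡ (x ℤ.- r) ℤ.+ d
  regroup = solve-∀
  c∣d' : + c ZS.∣ + d
  c∣d' = ZS.∣ᵤ⇒∣ c∣d
  to : c ℕD.∣ ∣ + k ℤ.- (r ℤ.- + d) ∣ → c ℕD.∣ ∣ + k ℤ.- r ∣
  to h = ZS.∣⇒∣ᵤ (ZS.∣m+n∣n⇒∣m {+ c} {+ k ℤ.- r} {+ d} (≡.subst (+ c ZS.∣_) (regroup (+ k) r (+ d)) (ZS.∣ᵤ⇒∣ h)) c∣d')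
  from : c ℕD.∣ ∣ + k ℤ.- r ∣ → c ℕD.∣ ∣ + k ℤ.- (r ℤ.- + d) ∣
  from h = ZS.∣⇒∣ᵤ (≡.subst (+ c ZS.∣_) (≡.sym (regroup (+ k) r (+ d))) (ZS.∣m∣n⇒∣m+n {+ c} {+ k ℤ.- r} {+ d} (ZS.∣ᵤ⇒∣ h) c∣d'))

C₂ : ℕ → ℕ
C₂ zero    = 0
C₂ (suc j) = C₂ j ℕ.+ j

nC2≡C₂ : ∀ n → n C 2 ≡ C₂ n
nC2≡C₂ zero    = refl
nC2≡C₂ (suc n) = ≡.trans (≡.sym (nCk+nC[k+1]≡[n+1]C[k+1] n 1))
  (≡.trans (≡.cong₂ ℕ._+_ (nC1≡n n) (nC2≡C₂ n)) (ℕP.+-comm n (C₂ n)))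

C₂-odd : ∀ e → C₂ (suc (e ℕ.+ e)) ≡ e ℕ.* suc (e ℕ.+ e)
C₂-even : ∀ e → C₂ (suc (suc (e ℕ.+ e))) ≡ suc e ℕ.* suc (e ℕ.+ e)
C₂-odd zero    = refl
C₂-odd (suc e) = ≡.trans (≡.cong (λ z → C₂ (suc (suc z))) (ℕP.+-suc e e))
  (≡.trans (≡.cong (ℕ._+ suc (suc (e ℕ.+ e))) (C₂-even e)) (step e))
  where step : ∀ e → suc e ℕ.* suc (e ℕ.+ e) ℕ.+ suc (suc (e ℕ.+ e)) ≡ suc e ℕ.* suc (suc e ℕ.+ suc e)
        step = ℕ-solve-∀
C₂-even e = ≡.trans (≡.cong (ℕ._+ suc (e ℕ.+ e)) (C₂-odd e)) (step e)
  where step : ∀ e → e ℕ.* suc (e ℕ.+ e) ℕ.+ suc (e ℕ.+ e) ≡ suc e ℕ.* suc (e ℕ.+ e)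
        step = ℕ-solve-∀

odd⊎even : ∀ d → 1 ≤ d → (Σ ℕ λ e → d ≡ suc (e ℕ.+ e)) ⊎ (Σ ℕ λ e → d ≡ suc (suc (e ℕ.+ e)))
odd⊎even (suc zero)          _ = inj₁ (0 , refl)
odd⊎even (suc (suc zero))    _ = inj₂ (0 , refl)
odd⊎even (suc (suc (suc d))) _ with odd⊎even (suc d) (s≤s z≤n)
... | inj₁ (e , eq) = inj₁ (suc e , ≡.cong (λ z → suc (suc z)) (≡.trans eq (≡.sym (ℕP.+-suc e e))))
... | inj₂ (e , eq) = inj₂ (suc e , ≡.cong (λ z → suc (suc z)) (≡.trans eq (≡.cong suc (≡.sym (ℕP.+-suc e e)))))

module GaussianBinomials (R : CommutativeRing 0ℓ 0ℓ) (ι : ℤ-Algebra R) (q : CommutativeRing.Carrier R) where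
  open CommutativeRingFacts R ι

  qBinomial : ℕ → ℕ → Carrier
  qBinomial n       zero    = 1#
  qBinomial zero    (suc k) = 0#
  qBinomial (suc n) (suc k) = q ^ suc k * qBinomial n (suc k) + qBinomial n k

  qBinomial-vanishes : ∀ n k → n < k → qBinomial n k ≈ 0#
  qBinomial-vanishes zero    (suc k) _         = ≈-refl
  qBinomial-vanishes (suc n) (suc k) (s≤s n<k) = ≈-trans
    (+-cong (≈-trans (*-congˡ (qBinomial-vanishes n (suc k) (ℕP.m<n⇒m<1+n n<k))) (zeroʳ _))
            (qBinomial-vanishes n k n<k))
    (+-identityˡ 0#)

  qBinomial-diagonal : ∀ n → qBinomial n n ≈ 1#
  qBinomial-diagonal zero    = ≈-refl
  qBinomial-diagonal (suc n) = ≈-trans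
    (+-cong (≈-trans (*-congˡ (qBinomial-vanishes n (suc n) ℕP.≤-refl)) (zeroʳ _)) (qBinomial-diagonal n))
    (+-identityˡ 1#)

  sign : ℕ → Carrier
  sign k = (- 1#) ^ k

  -- the k-th term of (y; q)_n = ∏_{i<n} (1 - y q^i) in its q-binomial expansion
  term : ℕ → Carrier → ℕ → Carrier
  term n y k = sign k * q ^ C₂ k * y ^ k * qBinomial n k

  term-zero : ∀ n y → term n y 0 ≈ 1#
  term-zero n y = ≈-trans (*-identityʳ _) (≈-trans (*-identityʳ _) (*-identityʳ _))

  term-cong : ∀ n k {y y'} → y ≈ y' → term n y k ≈ term n y' k
  term-cong n k y≈y' = *-congʳ (*-congˡ (^-congˡ k y≈y'))

  term-vanishes : ∀ n y → term n y (suc n) ≈ 0#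
  term-vanishes n y = ≈-trans (*-congˡ (qBinomial-vanishes n (suc n) ℕP.≤-refl)) (zeroʳ _)

  term-pascal : ∀ n y k → term (suc n) y (suc k) ≈ term n (y * q) (suc k) - y * term n (y * q) k
  term-pascal n y k = begin
    sign (suc k) * q ^ C₂ (suc k) * y ^ suc k * qBinomial (suc n) (suc k)
      ≈⟨ *-congʳ (*-congʳ (*-cong (-1*x≈-x (sign k)) (^-homo-* q (C₂ k) k))) ⟩
    (- sign k) * (q ^ C₂ k * q ^ k) * (y * y ^ k) * (q * q ^ k * qBinomial n (suc k) + qBinomial n k)
      ≈⟨ solve 8 (λ s Qc Qk Y Q yk G1 G0 →
           (:- s) :* (Qc :* Qk) :* (Y :* yk) :* (Q :* Qk :* G1 :+ G0)
           := (:- s) :* (Qc :* Qk) :* ((Y :* Q) :* (yk :* Qk)) :* G1 :- Y :* (s :* Qc :* (yk :* Qk) :* G0))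
           ≈-refl (sign k) (q ^ C₂ k) (q ^ k) y q (y ^ k) (qBinomial n (suc k)) (qBinomial n k) ⟩
    (- sign k) * (q ^ C₂ k * q ^ k) * ((y * q) * (y ^ k * q ^ k)) * qBinomial n (suc k)
      - y * (sign k * q ^ C₂ k * (y ^ k * q ^ k) * qBinomial n k)
      ≈⟨ +-cong (*-congʳ (*-cong (*-cong (≈-sym (-1*x≈-x (sign k))) (≈-sym (^-homo-* q (C₂ k) k)))
                                 (*-congˡ (≈-sym (^-distrib-* y q k)))))
                (-‿cong (*-congˡ (*-congʳ (*-congˡ (≈-sym (^-distrib-* y q k)))))) ⟩
    sign (suc k) * q ^ C₂ (suc k) * (y * q) ^ suc k * qBinomial n (suc k)
      - y * (sign k * q ^ C₂ k * (y * q) ^ k * qBinomial n k) ∎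

  q^_−1 : ℕ → Carrier
  q^ m −1 = q ^ m - 1#

  q^[m*k]−1 : ∀ m k → q^ (m ℕ.* k) −1 ≈ q^ m −1 * geometric (q ^ m) k
  q^[m*k]−1 m k = ≈-trans (+-congʳ (≈-sym (^-assocʳ q m k))) (≈-sym ([x-1]*geometric (q ^ m) k))

  q^[a+b]−1 : ∀ a b → q^ (a ℕ.+ b) −1 ≈ q ^ a * q^ b −1 + q^ a −1
  q^[a+b]−1 a b = begin
    q ^ (a ℕ.+ b) - 1#                   ≈⟨ +-congʳ (^-homo-* q a b) ⟩
    q ^ a * q ^ b - 1#                   ≈⟨ solve 3 (λ A B O → A :* B :- O := A :* (B :- O) :+ (A :* O :- O))
                                                    ≈-refl (q ^ a) (q ^ b) 1# ⟩
    q ^ a * q^ b −1 + (q ^ a * 1# - 1#)  ≈⟨ +-congˡ (+-congʳ (*-identityʳ _)) ⟩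
    q ^ a * q^ b −1 + q^ a −1            ∎

  sign-even : ∀ e → sign (e ℕ.+ e) ≈ 1#
  sign-even e = ≈-trans (^-homo-* (- 1#) e e) (square e)
    where
    square : ∀ e → sign e * sign e ≈ 1#
    square zero    = *-identityˡ 1#
    square (suc e) = ≈-trans (solve 2 (λ M S → (M :* S) :* (M :* S) := (M :* M) :* (S :* S)) ≈-refl (- 1#) (sign e))
                             (≈-trans (*-cong -1*-1≈1 (square e)) (*-identityˡ 1#))

  select : Bool → Carrier → Carrier
  select b x = if b then x else 0#

  select-cong : ∀ b {x y} → x ≈ y → select b x ≈ select b y
  select-cong true  x≈y = x≈y
  select-cong false x≈y = ≈-refl

  select-minus-scaled : ∀ b x y z → select b (x - y * z) ≈ select b x - y * select b z
  select-minus-scaled true  x y z = ≈-refl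
  select-minus-scaled false x y z =
    ≈-sym (≈-trans (+-congˡ (≈-trans (-‿cong (zeroʳ y)) -0≈0)) (+-identityˡ 0#))

  select-zero : ∀ b → select b 0# ≈ 0#
  select-zero true  = ≈-refl
  select-zero false = ≈-refl

  -- the sum of the theorem is multisection c r (q^h) n
  multisection : ℕ → ℤ → Carrier → ℕ → Carrier
  multisection c r y n = ∑ (suc n) (λ k → select (k ≡ᵇ r mod c) (term n y k))

  multisection-cong : ∀ c r n {y y'} → y ≈ y' → multisection c r y n ≈ multisection c r y' n
  multisection-cong c r n y≈y' = ∑-cong (suc n) (λ k _ → select-cong (k ≡ᵇ r mod c) (term-cong n k y≈y'))

  multisection-periodic : ∀ c d r y n → c ℕD.∣ d → multisection c (r ℤ.- + d) y n ≈ multisection c r y n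
  multisection-periodic c d r y n c∣d = ∑-cong (suc n) λ k _ →
    ≡.subst (λ b → select (k ≡ᵇ r ℤ.- + d mod c) (term n y k) ≈ select b (term n y k))
            (≡ᵇ-mod-periodic c d r k c∣d) ≈-refl

  multisection-pascal : ∀ c r y n →
    multisection c r y (suc n) ≈ multisection c r (y * q) n - y * multisection c (r ℤ.- 1ℤ) (y * q) n
  multisection-pascal c r y n = begin
    multisection c r y (suc n)
      ≈⟨ ∑-lower-index (suc n) _ ⟩
    s 0 (term (suc n) y 0) + ∑ (suc n) (λ k → s (suc k) (term (suc n) y (suc k)))
      ≈⟨ +-cong (select-cong (0 ≡ᵇ r mod c) (≈-trans (term-zero (suc n) y) (≈-sym (term-zero n (y * q)))))
                (∑-cong (suc n) λ k _ → ≈-trans (select-cong (suc k ≡ᵇ r mod c) (term-pascal n y k))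
                                                (select-minus-scaled (suc k ≡ᵇ r mod c) _ y _)) ⟩
    s 0 (t 0) + ∑ (suc n) (λ k → s (suc k) (t (suc k)) - y * s (suc k) (t k))
      ≈⟨ +-congˡ (∑-minus-scaled (suc n) _ y _) ⟩
    s 0 (t 0) + (∑ (suc n) (λ k → s (suc k) (t (suc k))) - y * ∑ (suc n) (λ k → s (suc k) (t k)))
      ≈⟨ solve 4 (λ X A B Y → X :+ (A :- Y :* B) := (X :+ A) :- Y :* B) ≈-refl _ _ _ y ⟩
    (s 0 (t 0) + ∑ (suc n) (λ k → s (suc k) (t (suc k)))) - y * ∑ (suc n) (λ k → s (suc k) (t k))
      ≈⟨ +-cong (≈-sym sections) (-‿cong (*-congˡ (∑-cong (suc n) λ k _ →
           ≡.subst (λ b → s (suc k) (t k) ≈ select b (t k)) (≡ᵇ-mod-suc c r k) ≈-refl))) ⟩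
    multisection c r (y * q) n - y * multisection c (r ℤ.- 1ℤ) (y * q) n ∎
    where
    s : ℕ → Carrier → Carrier
    s k = select (k ≡ᵇ r mod c)
    t : ℕ → Carrier
    t = term n (y * q)
    sections : multisection c r (y * q) n ≈ s 0 (t 0) + ∑ (suc n) (λ k → s (suc k) (t (suc k)))
    sections = ≈-trans
      (≈-sym (∑-last-zero (suc n) _ (≈-trans (select-cong (suc n ≡ᵇ r mod c) (term-vanishes n (y * q)))
                                              (select-zero (suc n ≡ᵇ r mod c)))))
      (∑-lower-index (suc n) _)

  ∑-term-pascal : ∀ m y (A : ℕ → Carrier) →
    ∑ (suc m) (λ j → term m (y * q) j * A j) - y * ∑ (suc m) (λ j → term m (y * q) j * A (suc j))
      ≈ ∑ (suc (suc m)) (λ j → term (suc m) y j * A j)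
  ∑-term-pascal m y A = begin
    ∑ (suc m) (λ j → t j * A j) - y * ∑ (suc m) (λ j → t j * A (suc j))
      ≈⟨ +-congʳ (≈-trans (≈-sym (∑-last-zero (suc m) _ (≈-trans (*-congʳ (term-vanishes m (y * q))) (zeroˡ _))))
                          (∑-lower-index (suc m) _)) ⟩
    (t 0 * A 0 + ∑ (suc m) (λ j → t (suc j) * A (suc j))) - y * ∑ (suc m) (λ j → t j * A (suc j))
      ≈⟨ solve 4 (λ X P Q Y → (X :+ P) :- Y :* Q := X :+ (P :- Y :* Q)) ≈-refl _ _ _ y ⟩
    t 0 * A 0 + (∑ (suc m) (λ j → t (suc j) * A (suc j)) - y * ∑ (suc m) (λ j → t j * A (suc j)))
      ≈⟨ +-cong (*-congʳ (≈-trans (term-zero m (y * q)) (≈-sym (term-zero (suc m) y))))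
                (≈-sym (∑-minus-scaled (suc m) _ y _)) ⟩
    term (suc m) y 0 * A 0 + ∑ (suc m) (λ j → t (suc j) * A (suc j) - y * (t j * A (suc j)))
      ≈⟨ +-congˡ (∑-cong (suc m) λ j _ → ≈-trans
           (solve 4 (λ P Y Q A → P :* A :- Y :* (Q :* A) := (P :- Y :* Q) :* A) ≈-refl (t (suc j)) y (t j) (A (suc j)))
           (*-congʳ (≈-sym (term-pascal m y j)))) ⟩
    term (suc m) y 0 * A 0 + ∑ (suc m) (λ j → term (suc m) y (suc j) * A (suc j))
      ≈⟨ ∑-lower-index (suc m) _ ⟨
    ∑ (suc (suc m)) (λ j → term (suc m) y j * A j) ∎
    where
    t : ℕ → Carrier
    t = term m (y * q)

  -- the multisected form of (y; q)_{m+n} = (y; q)_m (yq^m; q)_n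
  multisection-split : ∀ c r m n y →
    multisection c r y (m ℕ.+ n) ≈ ∑ (suc m) (λ j → term m y j * multisection c (r ℤ.- + j) (y * q ^ m) n)
  multisection-split c r zero n y = ≈-sym (begin
    0# + term 0 y 0 * multisection c (r ℤ.- + 0) (y * 1#) n
      ≈⟨ ≈-trans (+-identityˡ _) (*-congʳ (term-zero 0 y)) ⟩
    1# * multisection c (r ℤ.- + 0) (y * 1#) n
      ≈⟨ ≈-trans (*-identityˡ _) (multisection-cong c (r ℤ.- + 0) n (*-identityʳ y)) ⟩
    multisection c (r ℤ.- + 0) y n
      ≡⟨ ≡.cong (λ z → multisection c z y n) (ℤP.+-identityʳ r) ⟩
    multisection c r y n ∎)
  multisection-split c r (suc m) n y = begin
    multisection c r y (suc (m ℕ.+ n))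
      ≈⟨ multisection-pascal c r y (m ℕ.+ n) ⟩
    multisection c r (y * q) (m ℕ.+ n) - y * multisection c (r ℤ.- 1ℤ) (y * q) (m ℕ.+ n)
      ≈⟨ +-cong (multisection-split c r m n (y * q))
                (-‿cong (*-congˡ (multisection-split c (r ℤ.- 1ℤ) m n (y * q)))) ⟩
    ∑ (suc m) (λ j → t j * multisection c (r ℤ.- + j) (y * q * q ^ m) n)
      - y * ∑ (suc m) (λ j → t j * multisection c ((r ℤ.- 1ℤ) ℤ.- + j) (y * q * q ^ m) n)
      ≈⟨ +-cong (∑-cong (suc m) λ j _ → *-congˡ (multisection-cong c (r ℤ.- + j) n (*-assoc y q _)))
                (-‿cong (*-congˡ (∑-cong (suc m) λ j _ → *-congˡ (≈-trans
                  (multisection-cong c ((r ℤ.- 1ℤ) ℤ.- + j) n (*-assoc y q _))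
                  (≡.subst (λ z → M ((r ℤ.- 1ℤ) ℤ.- + j) ≈ M z) (r-1-j≡r-[1+j] r (+ j)) ≈-refl))))) ⟩
    ∑ (suc m) (λ j → t j * A j) - y * ∑ (suc m) (λ j → t j * A (suc j))
      ≈⟨ ∑-term-pascal m y A ⟩
    ∑ (suc (suc m)) (λ j → term (suc m) y j * A j) ∎
    where
    t : ℕ → Carrier
    t = term m (y * q)
    M : ℤ → Carrier
    M z = multisection c z (y * q ^ suc m) n
    A : ℕ → Carrier
    A j = M (r ℤ.- + j)
    r-1-j≡r-[1+j] : ∀ r x → (r ℤ.- 1ℤ) ℤ.- x ≡ r ℤ.- (1ℤ ℤ.+ x)
    r-1-j≡r-[1+j] = solve-∀

  [_]q : ℕ → Carrier
  [ zero  ]q = 0#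
  [ suc m ]q = 1# + q * [ m ]q

  [+]q : ∀ a b → [ a ℕ.+ b ]q ≈ [ a ]q + q ^ a * [ b ]q
  [+]q zero    b = ≈-sym (≈-trans (+-identityˡ _) (*-identityˡ _))
  [+]q (suc a) b = ≈-trans (+-congˡ (*-congˡ ([+]q a b)))
    (solve 5 (λ O Q A QA B → O :+ Q :* (A :+ QA :* B) := (O :+ Q :* A) :+ (Q :* QA) :* B) ≈-refl
           1# q [ a ]q (q ^ a) [ b ]q)

  [q-1]*[m]q≈q^m-1 : ∀ m → (q - 1#) * [ m ]q ≈ q ^ m - 1#
  [q-1]*[m]q≈q^m-1 zero    = ≈-trans (zeroʳ _) (≈-sym (-‿inverseʳ 1#))
  [q-1]*[m]q≈q^m-1 (suc m) = begin
    (q - 1#) * (1# + q * [ m ]q)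
      ≈⟨ solve 3 (λ Q O N → (Q :- O) :* (O :+ Q :* N) := (Q :- O) :* O :+ Q :* ((Q :- O) :* N)) ≈-refl q 1# [ m ]q ⟩
    (q - 1#) * 1# + q * ((q - 1#) * [ m ]q)
      ≈⟨ +-cong (*-identityʳ _) (*-congˡ ([q-1]*[m]q≈q^m-1 m)) ⟩
    (q - 1#) + q * (q ^ m - 1#)
      ≈⟨ solve 3 (λ Q O X → (Q :- O) :+ Q :* (X :- O) := Q :* X :- O :+ (Q :- Q :* O)) ≈-refl q 1# (q ^ m) ⟩
    q * q ^ m - 1# + (q - q * 1#)
      ≈⟨ +-congˡ (≈-trans (+-congˡ (-‿cong (*-identityʳ q))) (-‿inverseʳ q)) ⟩
    q * q ^ m - 1# + 0#
      ≈⟨ +-identityʳ _ ⟩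
    q ^ suc m - 1# ∎

  [_]q! : ℕ → Carrier
  [ k ]q! = ∏ k (λ i → [ suc i ]q)

  qFalling : ℕ → ℕ → Carrier
  qFalling n k = ∏ k (λ i → [ n ∸ i ]q)

  qFalling-vanishes : ∀ n k → n < k → qFalling n k ≈ 0#
  qFalling-vanishes n (suc k) (s≤s n≤k) with ℕP.m≤n⇒m<n∨m≡n n≤k
  ... | inj₂ refl = ≈-trans (*-congˡ (≡.subst (λ z → [ z ]q ≈ 0#) (≡.sym (ℕP.n∸n≡0 n)) ≈-refl)) (zeroʳ _)
  ... | inj₁ n<k  = ≈-trans (*-congʳ (qFalling-vanishes n k n<k)) (zeroˡ _)

  qFalling-suc : ∀ n k → qFalling (suc n) (suc k) ≈ [ suc n ]q * qFalling n k
  qFalling-suc n zero    = ≈-trans (*-identityˡ _) (≈-sym (*-identityʳ _))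
  qFalling-suc n (suc k) = ≈-trans (*-congʳ (qFalling-suc n k)) (*-assoc _ _ _)

  qBinomial*[k]q!≈qFalling : ∀ n k → qBinomial n k * [ k ]q! ≈ qFalling n k
  qBinomial*[k]q!≈qFalling n       zero    = *-identityˡ 1#
  qBinomial*[k]q!≈qFalling zero    (suc k) = ≈-trans (zeroˡ _) (≈-sym (qFalling-vanishes 0 (suc k) (s≤s z≤n)))
  qBinomial*[k]q!≈qFalling (suc n) (suc k) = begin
    (q ^ suc k * qBinomial n (suc k) + qBinomial n k) * ([ k ]q! * [ suc k ]q)
      ≈⟨ solve 5 (λ Q G1 G0 Fk N → (Q :* G1 :+ G0) :* (Fk :* N) := Q :* (G1 :* (Fk :* N)) :+ (G0 :* Fk) :* N)
               ≈-refl (q ^ suc k) (qBinomial n (suc k)) (qBinomial n k) [ k ]q! [ suc k ]q ⟩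
    q ^ suc k * (qBinomial n (suc k) * [ suc k ]q!) + (qBinomial n k * [ k ]q!) * [ suc k ]q
      ≈⟨ +-cong (*-congˡ (qBinomial*[k]q!≈qFalling n (suc k))) (*-congʳ (qBinomial*[k]q!≈qFalling n k)) ⟩
    q ^ suc k * (qFalling n k * [ n ∸ k ]q) + qFalling n k * [ suc k ]q
      ≈⟨ solve 4 (λ Q A B C → Q :* (A :* B) :+ A :* C := A :* (C :+ Q :* B)) ≈-refl
               (q ^ suc k) (qFalling n k) [ n ∸ k ]q [ suc k ]q ⟩
    qFalling n k * ([ suc k ]q + q ^ suc k * [ n ∸ k ]q)
      ≈⟨ falling-step ⟩
    [ suc n ]q * qFalling n k
      ≈⟨ qFalling-suc n k ⟨
    qFalling (suc n) (suc k) ∎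
    where
    falling-step : qFalling n k * ([ suc k ]q + q ^ suc k * [ n ∸ k ]q) ≈ [ suc n ]q * qFalling n k
    falling-step with ℕP.≤-<-connex k n
    ... | inj₁ k≤n = ≈-trans (*-congˡ (≈-sym (≈-trans
            (≡.subst (λ z → [ z ]q ≈ [ suc k ℕ.+ (n ∸ k) ]q) (≡.cong suc (ℕP.m+[n∸m]≡n k≤n)) ≈-refl)
            ([+]q (suc k) (n ∸ k))))) (*-comm _ _)
    ... | inj₂ n<k = ≈-trans (≈-trans (*-congʳ (qFalling-vanishes n k n<k)) (zeroˡ _))
                             (≈-sym (≈-trans (*-congˡ (qFalling-vanishes n k n<k)) (zeroʳ _)))

  record CyclotomicLike (d : ℕ) (φ : Carrier) : Set where
    field
      q^d≡1       : q ^ d ≡ 1# mod φ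
      ∣qBinomial  : ∀ j → 1 ≤ j → j < d → φ ∣ qBinomial d j
      ∣outerTerms : ∀ y → y ^ d ≡ 1# mod φ → φ ∣ 1# + sign d * q ^ C₂ d * y ^ d

  [y*q^d]^d≡1 : ∀ {d φ y} → q ^ d ≡ 1# mod φ → y ^ d ≡ 1# mod φ → (y * q ^ d) ^ d ≡ 1# mod φ
  [y*q^d]^d≡1 {d} {y = y} q^d≡1 y^d≡1 = ≡mod-trans (≈⇒≡mod (^-distrib-* y (q ^ d) d))
    (≡mod-trans (*-cong-mod y^d≡1 (≡mod-trans (≈⇒≡mod (^-swap q d d)) (^-≡1-mod d q^d≡1)))
                (≈⇒≡mod (*-identityˡ 1#)))

  multisection-outerTerms : ∀ {c d y} → c ℕD.∣ d → ∀ r Y n →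
    term d y 0 * multisection c (r ℤ.- + 0) Y n + term d y d * multisection c (r ℤ.- + d) Y n
      ≈ (1# + sign d * q ^ C₂ d * y ^ d) * multisection c r Y n
  multisection-outerTerms {c} {d} {y} c∣d r Y n = begin
    term d y 0 * multisection c (r ℤ.- + 0) Y n + term d y d * multisection c (r ℤ.- + d) Y n
      ≈⟨ +-cong (*-congʳ (term-zero d y))
                (*-cong (*-congˡ (qBinomial-diagonal d)) (multisection-periodic c d r Y n c∣d)) ⟩
    1# * multisection c (r ℤ.- + 0) Y n + (t * 1#) * multisection c r Y n
      ≡⟨ ≡.cong (λ z → 1# * multisection c z Y n + (t * 1#) * multisection c r Y n) (ℤP.+-identityʳ r) ⟩
    1# * multisection c r Y n + (t * 1#) * multisection c r Y n
      ≈⟨ +-congˡ (*-congʳ (*-identityʳ t)) ⟩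
    1# * multisection c r Y n + t * multisection c r Y n
      ≈⟨ distribʳ _ 1# t ⟨
    (1# + t) * multisection c r Y n ∎
    where
    t : Carrier
    t = sign d * q ^ C₂ d * y ^ d

  multisection-divisible : ∀ {d φ c} → CyclotomicLike d φ → 1 ≤ d → c ℕD.∣ d →
                           ∀ k {n} → k ℕ.* d ≤ n → ∀ {y} → y ^ d ≡ 1# mod φ →
                           ∀ r → φ ^ k ∣ multisection c r y n
  multisection-divisible _ _ _ zero _ _ _ = ε∣ʳ _
  multisection-divisible {suc d'} {φ} {c} φ-like 1≤d c∣d (suc k) {n} kd≤n {y} y^d≡1 r =
    ≡.subst (λ m → φ ^ suc k ∣ multisection c r y m) d+n'≡n (∣ʳ-respʳ-≈ (≈-sym split) (∣x∣y⇒∣x+y outer inner))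
    where
    open CyclotomicLike φ-like
    d : ℕ
    d = suc d'
    n' : ℕ
    n' = n ∸ d
    d+n'≡n : d ℕ.+ n' ≡ n
    d+n'≡n = ℕP.m+[n∸m]≡n (ℕP.≤-trans (ℕP.m≤m+n d (k ℕ.* d)) kd≤n)
    kd≤n' : k ℕ.* d ≤ n'
    kd≤n' = ℕP.+-cancelˡ-≤ d _ _ (≡.subst (λ m → d ℕ.+ k ℕ.* d ≤ m) (≡.sym d+n'≡n) kd≤n)
    Y : Carrier
    Y = y * q ^ d
    IH : ∀ r → φ ^ k ∣ multisection c r Y n'
    IH = multisection-divisible φ-like 1≤d c∣d k kd≤n' ([y*q^d]^d≡1 {d} q^d≡1 y^d≡1)
    g : ℕ → Carrier
    g j = term d y j * multisection c (r ℤ.- + j) Y n'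
    split : multisection c r y (d ℕ.+ n') ≈ (g 0 + g d) + ∑ d' (λ j → g (suc j))
    split = begin
      multisection c r y (d ℕ.+ n') ≈⟨ multisection-split c r d n' y ⟩
      ∑ (suc d) g                   ≈⟨ ∑-lower-index d g ⟩
      g 0 + (∑ d' (λ j → g (suc j)) + g d)
        ≈⟨ solve 3 (λ A M B → A :+ (M :+ B) := (A :+ B) :+ M) ≈-refl (g 0) _ (g d) ⟩
      (g 0 + g d) + ∑ d' (λ j → g (suc j)) ∎
    inner : φ ^ suc k ∣ ∑ d' (λ j → g (suc j))
    inner = ∣-∑ d' _ λ j j<d' →
      *-pres-∣ (x∣ʳy⇒x∣ʳzy _ (∣qBinomial (suc j) (s≤s z≤n) (s≤s j<d'))) (IH (r ℤ.- + suc j))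
    outer : φ ^ suc k ∣ g 0 + g d
    outer = ∣ʳ-respʳ-≈ (≈-sym (multisection-outerTerms c∣d r Y n'))
                        (*-pres-∣ (∣outerTerms y y^d≡1) (IH r))

module PolynomialRing where

  coeff-+P : ∀ p r i → coeff (p +P r) i ≡ coeff p i ℤ.+ coeff r i
  coeff-+P []      r       i       = ≡.sym (ℤP.+-identityˡ _)
  coeff-+P (a ∷ p) []      i       = ≡.sym (ℤP.+-identityʳ _)
  coeff-+P (a ∷ p) (b ∷ r) zero    = refl
  coeff-+P (a ∷ p) (b ∷ r) (suc i) = coeff-+P p r i

  coeff-scaleP : ∀ a p i → coeff (scaleP a p) i ≡ a ℤ.* coeff p i
  coeff-scaleP a []      i       = ≡.sym (ℤP.*-zeroʳ a)
  coeff-scaleP a (b ∷ p) zero    = refl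
  coeff-scaleP a (b ∷ p) (suc i) = coeff-scaleP a p i

  -- _≈P_ wrapped in a record, so that both sides can be inferred from a proof.
  infix 4 _≋_
  record _≋_ (p r : Poly) : Set where
    constructor mk≋
    field coeff-≡ : p ≈P r
  open _≋_ public

  ≋-refl : ∀ {p} → p ≋ p
  ≋-refl = mk≋ λ i → refl

  ≋-sym : ∀ {p r} → p ≋ r → r ≋ p
  ≋-sym (mk≋ e) = mk≋ λ i → ≡.sym (e i)

  ≋-trans : ∀ {p r s} → p ≋ r → r ≋ s → p ≋ s
  ≋-trans (mk≋ e) (mk≋ f) = mk≋ λ i → ≡.trans (e i) (f i)

  coeffwise : ∀ p r s t → (∀ i → coeff p i ℤ.+ coeff r i ≡ coeff s i ℤ.+ coeff t i) →
              (p +P r) ≋ (s +P t)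
  coeffwise p r s t e =
    mk≋ λ i → ≡.trans (coeff-+P p r i) (≡.trans (e i) (≡.sym (coeff-+P s t i)))

  ∷-cong : ∀ {a b p r} → a ≡ b → p ≋ r → (a ∷ p) ≋ (b ∷ r)
  ∷-cong e (mk≋ f) = mk≋ λ { zero → e ; (suc i) → f i }

  ∷-injectiveʳ : ∀ {a b p r} → (a ∷ p) ≋ (b ∷ r) → p ≋ r
  ∷-injectiveʳ (mk≋ e) = mk≋ λ i → e (suc i)

  +P-cong : ∀ {p p' r r'} → p ≋ p' → r ≋ r' → (p +P r) ≋ (p' +P r')
  +P-cong {p} {p'} {r} {r'} (mk≋ e) (mk≋ f) = coeffwise p r p' r' λ i → ≡.cong₂ ℤ._+_ (e i) (f i)

  scaleP-cong : ∀ a {p r} → p ≋ r → scaleP a p ≋ scaleP a r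
  scaleP-cong a {p} {r} (mk≋ e) = mk≋ λ i →
    ≡.trans (coeff-scaleP a p i) (≡.trans (≡.cong (a ℤ.*_) (e i)) (≡.sym (coeff-scaleP a r i)))

  +P-comm : ∀ p r → (p +P r) ≋ (r +P p)
  +P-comm p r = coeffwise p r r p λ i → ℤP.+-comm (coeff p i) (coeff r i)

  +P-assoc : ∀ p r s → ((p +P r) +P s) ≋ (p +P (r +P s))
  +P-assoc p r s = mk≋ λ i → begin
    coeff ((p +P r) +P s) i                 ≡⟨ coeff-+P (p +P r) s i ⟩
    coeff (p +P r) i ℤ.+ coeff s i          ≡⟨ ≡.cong (ℤ._+ coeff s i) (coeff-+P p r i) ⟩
    coeff p i ℤ.+ coeff r i ℤ.+ coeff s i   ≡⟨ ℤP.+-assoc (coeff p i) (coeff r i) (coeff s i) ⟩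
    coeff p i ℤ.+ (coeff r i ℤ.+ coeff s i) ≡⟨ ≡.cong (λ z → coeff p i ℤ.+ z) (coeff-+P r s i) ⟨
    coeff p i ℤ.+ coeff (r +P s) i          ≡⟨ coeff-+P p (r +P s) i ⟨
    coeff (p +P (r +P s)) i                 ∎
    where open ≡.≡-Reasoning

  +P-exchange : ∀ p r s → (p +P (r +P s)) ≋ (r +P (p +P s))
  +P-exchange p r s = ≋-trans (≋-sym (+P-assoc p r s))
                       (≋-trans (+P-cong (+P-comm p r) ≋-refl) (+P-assoc r p s))

  []≋0 : [] ≋ (0ℤ ∷ [])
  []≋0 = mk≋ λ { zero → refl ; (suc i) → refl }

  0∷-≋[] : ∀ {p} → p ≋ [] → (0ℤ ∷ p) ≋ []
  0∷-≋[] (mk≋ e) = mk≋ λ { zero → refl ; (suc i) → e i }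

  *P-zeroʳ : ∀ p → (p *P []) ≋ []
  *P-zeroʳ []      = ≋-refl
  *P-zeroʳ (a ∷ p) = 0∷-≋[] (*P-zeroʳ p)

  *P-∷ʳ : ∀ p b r → (p *P (b ∷ r)) ≋ (scaleP b p +P (0ℤ ∷ (p *P r)))
  *P-∷ʳ []      b r = []≋0
  *P-∷ʳ (a ∷ p) b r = ∷-cong (≡.cong (ℤ._+ 0ℤ) (ℤP.*-comm a b))
    (≋-trans (+P-cong (≋-refl {scaleP a r}) (*P-∷ʳ p b r))
             (+P-exchange (scaleP a r) (scaleP b p) (0ℤ ∷ (p *P r))))

  *P-comm : ∀ p r → (p *P r) ≋ (r *P p)
  *P-comm []      r = ≋-sym (*P-zeroʳ r)
  *P-comm (a ∷ p) r = ≋-trans (+P-cong (≋-refl {scaleP a r}) (∷-cong refl (*P-comm p r)))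
                               (≋-sym (*P-∷ʳ r a p))

  *P-congˡ : ∀ p {r r'} → r ≋ r' → (p *P r) ≋ (p *P r')
  *P-congˡ []      e = ≋-refl
  *P-congˡ (a ∷ p) e = +P-cong (scaleP-cong a e) (∷-cong refl (*P-congˡ p e))

  *P-cong : ∀ {p p' r r'} → p ≋ p' → r ≋ r' → (p *P r) ≋ (p' *P r')
  *P-cong {p} {p'} {r} {r'} e f =
    ≋-trans (*P-congˡ p f) (≋-trans (*P-comm p r') (≋-trans (*P-congˡ r' e) (*P-comm r' p')))

  scaleP-+P : ∀ a p r → scaleP a (p +P r) ≋ (scaleP a p +P scaleP a r)
  scaleP-+P a p r = mk≋ λ i → begin
    coeff (scaleP a (p +P r)) i                          ≡⟨ coeff-scaleP a (p +P r) i ⟩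
    a ℤ.* coeff (p +P r) i                               ≡⟨ ≡.cong (a ℤ.*_) (coeff-+P p r i) ⟩
    a ℤ.* (coeff p i ℤ.+ coeff r i)                      ≡⟨ ℤP.*-distribˡ-+ a _ _ ⟩
    a ℤ.* coeff p i ℤ.+ a ℤ.* coeff r i                  ≡⟨ ≡.cong₂ ℤ._+_ (coeff-scaleP a p i) (coeff-scaleP a r i) ⟨
    coeff (scaleP a p) i ℤ.+ coeff (scaleP a r) i        ≡⟨ coeff-+P (scaleP a p) (scaleP a r) i ⟨
    coeff (scaleP a p +P scaleP a r) i                   ∎
    where open ≡.≡-Reasoning

  scaleP-scaleP : ∀ a b p → scaleP a (scaleP b p) ≋ scaleP (a ℤ.* b) p
  scaleP-scaleP a b p = mk≋ λ i →
    ≡.trans (coeff-scaleP a (scaleP b p) i) (≡.trans (≡.cong (a ℤ.*_) (coeff-scaleP b p i))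
      (≡.trans (≡.sym (ℤP.*-assoc a b _)) (≡.sym (coeff-scaleP (a ℤ.* b) p i))))

  *P-distribˡ-+P : ∀ p r s → (p *P (r +P s)) ≋ ((p *P r) +P (p *P s))
  *P-distribˡ-+P []      r s = ≋-refl
  *P-distribˡ-+P (a ∷ p) r s =
    ≋-trans (+P-cong (scaleP-+P a r s) (∷-cong refl (*P-distribˡ-+P p r s)))
    (≋-trans (+P-assoc (scaleP a r) (scaleP a s) _)
    (≋-trans (+P-cong (≋-refl {scaleP a r}) (+P-exchange (scaleP a s) (0ℤ ∷ (p *P r)) (0ℤ ∷ (p *P s))))
             (≋-sym (+P-assoc (scaleP a r) _ _))))

  scaleP-*P : ∀ a p r → scaleP a (p *P r) ≋ (scaleP a p *P r)
  scaleP-*P a []      r = ≋-refl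
  scaleP-*P a (b ∷ p) r = ≋-trans (scaleP-+P a (scaleP b r) _)
    (+P-cong (scaleP-scaleP a b r) (∷-cong (ℤP.*-zeroʳ a) (scaleP-*P a p r)))

  scaleP-zero : ∀ p → scaleP 0ℤ p ≋ []
  scaleP-zero p = mk≋ λ i → coeff-scaleP 0ℤ p i

  0∷-*P : ∀ p s → ((0ℤ ∷ p) *P s) ≋ (0ℤ ∷ (p *P s))
  0∷-*P p s = +P-cong (scaleP-zero s) ≋-refl

  *P-assoc : ∀ p r s → ((p *P r) *P s) ≋ (p *P (r *P s))
  *P-assoc []      r s = ≋-refl
  *P-assoc (a ∷ p) r s =
    ≋-trans (≋-trans (*P-comm (scaleP a r +P (0ℤ ∷ (p *P r))) s) (*P-distribˡ-+P s _ _))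
      (+P-cong (≋-trans (*P-comm s (scaleP a r)) (≋-sym (scaleP-*P a r s)))
               (≋-trans (*P-comm s _) (≋-trans (0∷-*P (p *P r) s) (∷-cong refl (*P-assoc p r s)))))

  *P-identityˡ : ∀ p → (oneP *P p) ≋ p
  *P-identityˡ p = mk≋ λ i → ≡.trans (coeff-+P (scaleP 1ℤ p) (0ℤ ∷ []) i)
    (≡.trans (≡.cong₂ ℤ._+_ (coeff-scaleP 1ℤ p i) (coeff-≡ (≋-sym []≋0) i))
      (≡.trans (ℤP.+-identityʳ _) (ℤP.*-identityˡ _)))

  negP : Poly → Poly
  negP = scaleP (ℤ.- 1ℤ)

  negP-inverseˡ : ∀ p → (negP p +P p) ≋ []
  negP-inverseˡ p = mk≋ λ i → ≡.trans (coeff-+P (negP p) p i)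
    (≡.trans (≡.cong (ℤ._+ coeff p i) (≡.trans (coeff-scaleP (ℤ.- 1ℤ) p i) (ℤP.-1*i≡-i (coeff p i))))
             (ℤP.+-inverseˡ (coeff p i)))

  ℤ[q] : CommutativeRing 0ℓ 0ℓ
  ℤ[q] = record
    { Carrier = Poly ; _≈_ = _≋_ ; _+_ = _+P_ ; _*_ = _*P_ ; -_ = negP ; 0# = [] ; 1# = oneP
    ; isCommutativeRing = record
      { isRing = record
        { +-isAbelianGroup = record
          { isGroup = record
            { isMonoid = record
              { isSemigroup = record
                { isMagma = record
                  { isEquivalence = record { refl = ≋-refl ; sym = ≋-sym ; trans = ≋-trans }
                  ; ∙-cong = +P-cong }
                ; assoc = +P-assoc }
              ; identity = (λ p → ≋-refl) , (λ p → +P-comm p []) }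
            ; inverse = negP-inverseˡ , (λ p → ≋-trans (+P-comm p (negP p)) (negP-inverseˡ p))
            ; ⁻¹-cong = scaleP-cong (ℤ.- 1ℤ) }
          ; comm = +P-comm }
        ; *-cong = *P-cong
        ; *-assoc = *P-assoc
        ; *-identity = *P-identityˡ , (λ p → ≋-trans (*P-comm p oneP) (*P-identityˡ p))
        ; distrib = *P-distribˡ-+P
                  , (λ p r s → ≋-trans (*P-comm (r +P s) p)
                      (≋-trans (*P-distribˡ-+P p r s) (+P-cong (*P-comm p r) (*P-comm p s)))) }
      ; *-comm = *P-comm } }

module PolynomialFacts where
  open PolynomialRing

  constP : ℤ → Poly
  constP a = a ∷ []

  ℤ↦ℤ[q] : ℤ-Algebra ℤ[q]
  ℤ↦ℤ[q] = record
    { ⟦_⟧    = constP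
    ; +-homo = λ a b → ≋-refl
    ; *-homo = λ a b → mk≋ λ { zero → ≡.sym (ℤP.+-identityʳ _) ; (suc i) → refl }
    ; -‿homo = λ a → mk≋ λ { zero → ≡.sym (ℤP.-1*i≡-i a) ; (suc i) → refl }
    ; 0-homo = ≋-sym []≋0
    ; 1-homo = ≋-refl }

  module PolySolver = ℤ-Solver ℤ[q] ℤ↦ℤ[q]

  constP-*P : ∀ a p → (constP a *P p) ≋ scaleP a p
  constP-*P a p = ≋-trans (+P-cong ≋-refl (≋-sym []≋0)) (+P-comm (scaleP a p) [])

  X^1-*P : ∀ p → (X^ 1 *P p) ≋ (0ℤ ∷ p)
  X^1-*P p = ≋-trans (+P-cong (scaleP-zero p) (∷-cong refl (*P-identityˡ p))) ≋-refl

  X^-+ : ∀ m n → X^ (m ℕ.+ n) ≋ (X^ m *P X^ n)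
  X^-+ zero    n = ≋-sym (*P-identityˡ (X^ n))
  X^-+ (suc m) n = ≋-trans (∷-cong refl (X^-+ m n)) (≋-sym (0∷-*P (X^ m) (X^ n)))

  X^-*P-+ : ∀ m n p → (X^ (m ℕ.+ n) *P p) ≋ (X^ m *P X^ n *P p)
  X^-*P-+ m n p = *P-cong (X^-+ m n) ≋-refl

  X^-cancelˡ : ∀ m {p r} → (X^ m *P p) ≋ (X^ m *P r) → p ≋ r
  X^-cancelˡ zero    {p} {r} e = ≋-trans (≋-sym (*P-identityˡ p)) (≋-trans e (*P-identityˡ r))
  X^-cancelˡ (suc m) {p} {r} e = X^-cancelˡ m (∷-injectiveʳ
    (≋-trans (≋-sym (0∷-*P (X^ m) p)) (≋-trans e (0∷-*P (X^ m) r))))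

  IsUnitℤ : ℤ → Set
  IsUnitℤ u = ∣ u ∣ ≡ 1

  UnitConstant : Poly → Set
  UnitConstant A = IsUnitℤ (coeff A 0)

  _∣Coeffs_ : ℤ → Poly → Set
  N ∣Coeffs p = ∀ i → N ZS.∣ coeff p i

  coeff-*P-zero : ∀ p r → coeff (p *P r) 0 ≡ coeff p 0 ℤ.* coeff r 0
  coeff-*P-zero []      r = ≡.sym (ℤP.*-zeroˡ (coeff r 0))
  coeff-*P-zero (a ∷ p) r =
    ≡.trans (coeff-+P (scaleP a r) _ 0) (≡.trans (ℤP.+-identityʳ _) (coeff-scaleP a r 0))

  isUnitℤ-* : ∀ u v → IsUnitℤ u → IsUnitℤ v → IsUnitℤ (u ℤ.* v)
  isUnitℤ-* u v ∣u∣≡1 ∣v∣≡1 = ≡.trans (ℤP.abs-* u v) (≡.cong₂ ℕ._*_ ∣u∣≡1 ∣v∣≡1)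

  isUnitℤ-*⁻ : ∀ u v → IsUnitℤ (u ℤ.* v) → IsUnitℤ u × IsUnitℤ v
  isUnitℤ-*⁻ u v ∣uv∣≡1 = ℕP.m*n≡1⇒m≡1 (∣ u ∣) (∣ v ∣) ∣u∣*∣v∣≡1 , ℕP.m*n≡1⇒n≡1 (∣ u ∣) (∣ v ∣) ∣u∣*∣v∣≡1
    where
    ∣u∣*∣v∣≡1 : ∣ u ∣ ℕ.* ∣ v ∣ ≡ 1
    ∣u∣*∣v∣≡1 = ≡.trans (≡.sym (ℤP.abs-* u v)) ∣uv∣≡1

  ∣-cancel-unit : ∀ {N b u} → IsUnitℤ u → N ZS.∣ b ℤ.* u → N ZS.∣ b
  ∣-cancel-unit {N} {b} {u} ∣u∣≡1 N∣bu = ZS.∣ᵤ⇒∣ (≡.subst (∣ N ∣ ℕD.∣_) ∣bu∣≡∣b∣ (ZS.∣⇒∣ᵤ N∣bu))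
    where
    ∣bu∣≡∣b∣ : ∣ b ℤ.* u ∣ ≡ ∣ b ∣
    ∣bu∣≡∣b∣ = ≡.trans (ℤP.abs-* b u) (≡.trans (≡.cong (∣ b ∣ ℕ.*_) ∣u∣≡1) (ℕP.*-identityʳ ∣ b ∣))

  unitConstant-*P : ∀ p r → UnitConstant p → UnitConstant r → UnitConstant (p *P r)
  unitConstant-*P p r up ur = ≡.subst IsUnitℤ (≡.sym (coeff-*P-zero p r)) (isUnitℤ-* (coeff p 0) (coeff r 0) up ur)

  unitConstant-∈-prodP : ∀ {p} ps → p ∈ ps → UnitConstant (prodP ps) → UnitConstant p
  unitConstant-∈-prodP (r ∷ ps) p∈ unit with isUnitℤ-*⁻ (coeff r 0) (coeff (prodP ps) 0)
                                                (≡.subst IsUnitℤ (coeff-*P-zero r (prodP ps)) unit)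
  unitConstant-∈-prodP (r ∷ ps) (here refl) unit | ur , _   = ur
  unitConstant-∈-prodP (r ∷ ps) (there p∈) unit | _  , ups = unitConstant-∈-prodP ps p∈ ups

  -- Long division by A, one coefficient of Q at a time, starting from the constant term.
  ∣Coeffs-cancelˡ : ∀ A Q N → UnitConstant A → N ∣Coeffs (A *P Q) → N ∣Coeffs Q
  ∣Coeffs-cancelˡ A []      N unit N∣AQ i = ZS.divides 0ℤ refl
  ∣Coeffs-cancelˡ A (b ∷ Q) N unit N∣AQ = N∣bQ
    where
    N∣bA+Q : N ∣Coeffs (scaleP b A +P (0ℤ ∷ (A *P Q)))
    N∣bA+Q i = ≡.subst (N ZS.∣_) (coeff-≡ (*P-∷ʳ A b Q) i) (N∣AQ i)
    N∣b : N ZS.∣ b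
    N∣b = ∣-cancel-unit unit (≡.subst (N ZS.∣_)
      (≡.trans (coeff-+P (scaleP b A) (0ℤ ∷ (A *P Q)) 0)
               (≡.trans (ℤP.+-identityʳ _) (coeff-scaleP b A 0))) (N∣bA+Q 0))
    N∣AQ' : N ∣Coeffs (A *P Q)
    N∣AQ' i = ZS.∣m+n∣m⇒∣n (≡.subst (N ZS.∣_) (coeff-+P (scaleP b A) _ (suc i)) (N∣bA+Q (suc i)))
      (≡.subst (N ZS.∣_) (≡.sym (coeff-scaleP b A (suc i))) (ZS.∣m⇒∣m*n (coeff A (suc i)) N∣b))
    N∣bQ : N ∣Coeffs (b ∷ Q)
    N∣bQ zero    = N∣b
    N∣bQ (suc i) = ∣Coeffs-cancelˡ A Q N unit N∣AQ' i

  ∣Coeffs⇒scaleP : ∀ Q N → N ∣Coeffs Q → Σ Poly λ Q' → Q ≋ scaleP N Q'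
  ∣Coeffs⇒scaleP []      N N∣Q = [] , ≋-refl
  ∣Coeffs⇒scaleP (b ∷ Q) N N∣Q with N∣Q 0 | ∣Coeffs⇒scaleP Q N (λ i → N∣Q (suc i))
  ... | ZS.divides t b≡tN | Q' , Q≋NQ' =
    (t ∷ Q') , mk≋ λ { zero → ≡.trans b≡tN (ℤP.*-comm t N) ; (suc i) → coeff-≡ Q≋NQ' i }

  scaleP-cancel : ∀ N {p r} → N ≢ 0ℤ → scaleP N p ≋ scaleP N r → p ≋ r
  scaleP-cancel N {p} {r} N≢0 (mk≋ e) = mk≋ λ i →
    ℤP.*-cancelˡ-≡ N (coeff p i) (coeff r i) {{ℤ.≢-nonZero N≢0}}
      (≡.trans (≡.sym (coeff-scaleP N p i)) (≡.trans (e i) (coeff-scaleP N r i)))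

module LaurentRing where
  open PolynomialRing
  open PolynomialFacts
  open PolySolver using (_:+_; _:*_; :-_; con; _:=_; solve)
  open import Relation.Binary.Reasoning.Setoid (CommutativeRing.setoid ℤ[q])

  infix 4 _≋L_
  record _≋L_ (A B : Laurent) : Set where
    constructor mk≋L
    field cross-≋ : (X^ (Laurent.den B) *P Laurent.num A) ≋ (X^ (Laurent.den A) *P Laurent.num B)
  open _≋L_ public

  negL : Laurent → Laurent
  negL (p /q^ m) = negP p /q^ m

  oneL : Laurent
  oneL = oneP /q^ 0

  ≋L-refl : ∀ {A} → A ≋L A
  ≋L-refl = mk≋L ≋-refl

  ≋L-sym : ∀ {A B} → A ≋L B → B ≋L A
  ≋L-sym (mk≋L e) = mk≋L (≋-sym e)

  ≋L-trans : ∀ {A B C} → A ≋L B → B ≋L C → A ≋L C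
  ≋L-trans {p /q^ a} {r /q^ b} {s /q^ c} (mk≋L e) (mk≋L f) = mk≋L (X^-cancelˡ b (begin
     X^ b *P (X^ c *P p) ≈⟨ solve 3 (λ B C P → B :* (C :* P) := C :* (B :* P)) ≋-refl (X^ b) (X^ c) p ⟩
     X^ c *P (X^ b *P p) ≈⟨ *P-congˡ (X^ c) e ⟩
     X^ c *P (X^ a *P r) ≈⟨ solve 3 (λ A C P → C :* (A :* P) := A :* (C :* P)) ≋-refl (X^ a) (X^ c) r ⟩
     X^ a *P (X^ c *P r) ≈⟨ *P-congˡ (X^ a) f ⟩
     X^ a *P (X^ b *P s) ≈⟨ solve 3 (λ A B P → A :* (B :* P) := B :* (A :* P)) ≋-refl (X^ a) (X^ b) s ⟩
     X^ b *P (X^ a *P s) ∎))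

  +L-cong : ∀ {A A' B B'} → A ≋L A' → B ≋L B' → (A +L B) ≋L (A' +L B')
  +L-cong {p /q^ a} {p' /q^ a'} {r /q^ b} {r' /q^ b'} (mk≋L e) (mk≋L f) = mk≋L (begin
    X^ (a' ℕ.+ b') *P (X^ b *P p +P X^ a *P r)
      ≈⟨ X^-*P-+ a' b' _ ⟩
    X^ a' *P X^ b' *P (X^ b *P p +P X^ a *P r)
      ≈⟨ solve 6 (λ A' B' B A P R → A' :* B' :* (B :* P :+ A :* R)
                                    := B :* B' :* (A' :* P) :+ A :* A' :* (B' :* R))
               ≋-refl (X^ a') (X^ b') (X^ b) (X^ a) p r ⟩
    X^ b *P X^ b' *P (X^ a' *P p) +P X^ a *P X^ a' *P (X^ b' *P r)
      ≈⟨ +P-cong (*P-congˡ (X^ b *P X^ b') e) (*P-congˡ (X^ a *P X^ a') f) ⟩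
    X^ b *P X^ b' *P (X^ a *P p') +P X^ a *P X^ a' *P (X^ b *P r')
      ≈⟨ solve 6 (λ A' B' B A P R → B :* B' :* (A :* P) :+ A :* A' :* (B :* R)
                                    := A :* B :* (B' :* P :+ A' :* R))
               ≋-refl (X^ a') (X^ b') (X^ b) (X^ a) p' r' ⟩
    X^ a *P X^ b *P (X^ b' *P p' +P X^ a' *P r')
      ≈⟨ X^-*P-+ a b _ ⟨
    X^ (a ℕ.+ b) *P (X^ b' *P p' +P X^ a' *P r') ∎)

  *L-cong : ∀ {A A' B B'} → A ≋L A' → B ≋L B' → (A *L B) ≋L (A' *L B')
  *L-cong {p /q^ a} {p' /q^ a'} {r /q^ b} {r' /q^ b'} (mk≋L e) (mk≋L f) = mk≋L (begin
    X^ (a' ℕ.+ b') *P (p *P r)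
      ≈⟨ X^-*P-+ a' b' _ ⟩
    X^ a' *P X^ b' *P (p *P r)
      ≈⟨ solve 4 (λ A' B' P R → A' :* B' :* (P :* R) := (A' :* P) :* (B' :* R)) ≋-refl (X^ a') (X^ b') p r ⟩
    (X^ a' *P p) *P (X^ b' *P r)
      ≈⟨ *P-cong e f ⟩
    (X^ a *P p') *P (X^ b *P r')
      ≈⟨ solve 4 (λ A B P R → (A :* P) :* (B :* R) := A :* B :* (P :* R)) ≋-refl (X^ a) (X^ b) p' r' ⟩
    X^ a *P X^ b *P (p' *P r')
      ≈⟨ X^-*P-+ a b _ ⟨
    X^ (a ℕ.+ b) *P (p' *P r') ∎)

  negL-cong : ∀ {A A'} → A ≋L A' → negL A ≋L negL A'
  negL-cong {p /q^ a} {p' /q^ a'} (mk≋L e) = mk≋L (begin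
    X^ a' *P negP p ≈⟨ solve 2 (λ A P → A :* (:- P) := :- (A :* P)) ≋-refl (X^ a') p ⟩
    negP (X^ a' *P p) ≈⟨ scaleP-cong (ℤ.- 1ℤ) e ⟩
    negP (X^ a *P p') ≈⟨ solve 2 (λ A P → :- (A :* P) := A :* (:- P)) ≋-refl (X^ a) p' ⟩
    X^ a *P negP p' ∎)

  +L-assoc : ∀ A B C → ((A +L B) +L C) ≋L (A +L (B +L C))
  +L-assoc (p /q^ a) (r /q^ b) (s /q^ c) = mk≋L (begin
    X^ (a ℕ.+ (b ℕ.+ c)) *P (X^ c *P (X^ b *P p +P X^ a *P r) +P X^ (a ℕ.+ b) *P s)
       ≈⟨ *P-cong (≋-trans (X^-+ a _) (*P-congˡ (X^ a) (X^-+ b c))) (+P-cong ≋-refl (X^-*P-+ a b s)) ⟩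
    X^ a *P (X^ b *P X^ c) *P (X^ c *P (X^ b *P p +P X^ a *P r) +P X^ a *P X^ b *P s)
       ≈⟨ solve 6 (λ A B C P R S → A :* (B :* C) :* (C :* (B :* P :+ A :* R) :+ A :* B :* S)
                                   := A :* B :* C :* (B :* C :* P :+ A :* (C :* R :+ B :* S)))
                ≋-refl (X^ a) (X^ b) (X^ c) p r s ⟩
    X^ a *P X^ b *P X^ c *P (X^ b *P X^ c *P p +P X^ a *P (X^ c *P r +P X^ b *P s))
       ≈⟨ *P-cong (*P-cong (X^-+ a b) ≋-refl) (+P-cong (X^-*P-+ b c p) ≋-refl) ⟨
    X^ (a ℕ.+ b) *P X^ c *P (X^ (b ℕ.+ c) *P p +P X^ a *P (X^ c *P r +P X^ b *P s))
       ≈⟨ X^-*P-+ (a ℕ.+ b) c _ ⟨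
    X^ ((a ℕ.+ b) ℕ.+ c) *P (X^ (b ℕ.+ c) *P p +P X^ a *P (X^ c *P r +P X^ b *P s)) ∎)

  +L-comm : ∀ A B → (A +L B) ≋L (B +L A)
  +L-comm (p /q^ a) (r /q^ b) = mk≋L (begin
    X^ (b ℕ.+ a) *P (X^ b *P p +P X^ a *P r)
      ≈⟨ X^-*P-+ b a _ ⟩
    X^ b *P X^ a *P (X^ b *P p +P X^ a *P r)
      ≈⟨ solve 4 (λ B A P R → B :* A :* (B :* P :+ A :* R) := A :* B :* (A :* R :+ B :* P)) ≋-refl (X^ b) (X^ a) p r ⟩
    X^ a *P X^ b *P (X^ a *P r +P X^ b *P p)
      ≈⟨ X^-*P-+ a b _ ⟨
    X^ (a ℕ.+ b) *P (X^ a *P r +P X^ b *P p) ∎)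

  +L-identityˡ : ∀ A → (zeroL +L A) ≋L A
  +L-identityˡ (p /q^ a) = mk≋L (*P-congˡ (X^ a) (+P-cong (*P-zeroʳ (X^ a)) (*P-identityˡ p)))

  +L-inverseˡ : ∀ A → (negL A +L A) ≋L zeroL
  +L-inverseˡ (p /q^ a) = mk≋L (≋-trans
    (solve 2 (λ A P → con 1ℤ :* (A :* (:- P) :+ A :* P) := con 0ℤ) ≋-refl (X^ a) p)
    (≋-trans (≋-sym []≋0) (≋-sym (*P-zeroʳ (X^ (a ℕ.+ a))))))

  *L-assoc : ∀ A B C → ((A *L B) *L C) ≋L (A *L (B *L C))
  *L-assoc (p /q^ a) (r /q^ b) (s /q^ c) rewrite ℕP.+-assoc a b c =
    mk≋L (*P-congˡ (X^ (a ℕ.+ (b ℕ.+ c))) (*P-assoc p r s))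

  *L-comm : ∀ A B → (A *L B) ≋L (B *L A)
  *L-comm (p /q^ a) (r /q^ b) rewrite ℕP.+-comm a b =
    mk≋L (*P-congˡ (X^ (b ℕ.+ a)) (*P-comm p r))

  *L-identityˡ : ∀ A → (oneL *L A) ≋L A
  *L-identityˡ (p /q^ a) = mk≋L (*P-congˡ (X^ a) (*P-identityˡ p))

  *L-distribˡ-+L : ∀ A B C → (A *L (B +L C)) ≋L ((A *L B) +L (A *L C))
  *L-distribˡ-+L (p /q^ a) (r /q^ b) (s /q^ c) = mk≋L (begin
    X^ ((a ℕ.+ b) ℕ.+ (a ℕ.+ c)) *P (p *P (X^ c *P r +P X^ b *P s))
      ≈⟨ *P-cong (≋-trans (X^-+ (a ℕ.+ b) _) (*P-cong (X^-+ a b) (X^-+ a c))) ≋-refl ⟩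
    (X^ a *P X^ b) *P (X^ a *P X^ c) *P (p *P (X^ c *P r +P X^ b *P s))
      ≈⟨ solve 6 (λ A B C P R S → (A :* B) :* (A :* C) :* (P :* (C :* R :+ B :* S))
                                  := A :* (B :* C) :* ((A :* C) :* (P :* R) :+ (A :* B) :* (P :* S)))
               ≋-refl (X^ a) (X^ b) (X^ c) p r s ⟩
    X^ a *P (X^ b *P X^ c) *P ((X^ a *P X^ c) *P (p *P r) +P (X^ a *P X^ b) *P (p *P s))
      ≈⟨ *P-cong (≋-trans (X^-+ a _) (*P-congˡ (X^ a) (X^-+ b c))) (+P-cong (X^-*P-+ a c _) (X^-*P-+ a b _)) ⟨
    X^ (a ℕ.+ (b ℕ.+ c)) *P (X^ (a ℕ.+ c) *P (p *P r) +P X^ (a ℕ.+ b) *P (p *P s)) ∎)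

  laurentRing : CommutativeRing 0ℓ 0ℓ
  laurentRing = record
    { Carrier = Laurent ; _≈_ = _≋L_ ; _+_ = _+L_ ; _*_ = _*L_ ; -_ = negL ; 0# = zeroL ; 1# = oneL
    ; isCommutativeRing = record
      { isRing = record
        { +-isAbelianGroup = record
          { isGroup = record
            { isMonoid = record
              { isSemigroup = record
                { isMagma = record
                  { isEquivalence = record { refl = ≋L-refl ; sym = ≋L-sym ; trans = ≋L-trans }
                  ; ∙-cong = +L-cong }
                ; assoc = +L-assoc }
              ; identity = +L-identityˡ , (λ A → ≋L-trans (+L-comm A zeroL) (+L-identityˡ A)) }
            ; inverse = +L-inverseˡ , (λ A → ≋L-trans (+L-comm A (negL A)) (+L-inverseˡ A))
            ; ⁻¹-cong = negL-cong }
          ; comm = +L-comm }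
        ; *-cong = *L-cong
        ; *-assoc = *L-assoc
        ; *-identity = *L-identityˡ , (λ A → ≋L-trans (*L-comm A oneL) (*L-identityˡ A))
        ; distrib = *L-distribˡ-+L
                  , (λ A B C → ≋L-trans (*L-comm (B +L C) A)
                      (≋L-trans (*L-distribˡ-+L A B C) (+L-cong (*L-comm A B) (*L-comm A C)))) }
      ; *-comm = *L-comm } }

  fromPoly-cong : ∀ {p r} → p ≋ r → fromPoly p ≋L fromPoly r
  fromPoly-cong e = mk≋L (*P-congˡ oneP e)

  ℤ↦laurentRing : ℤ-Algebra laurentRing
  ℤ↦laurentRing = record
    { ⟦_⟧    = λ a → fromPoly (constP a)
    ; +-homo = λ a b → fromPoly-cong (≋-sym (+P-cong (*P-identityˡ (constP a)) (*P-identityˡ (constP b))))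
    ; *-homo = λ a b → fromPoly-cong (_-Raw-AlmostCommutative⟶_.*-homo ℤ↦ℤ[q] a b)
    ; -‿homo = λ a → fromPoly-cong (_-Raw-AlmostCommutative⟶_.-‿homo ℤ↦ℤ[q] a)
    ; 0-homo = fromPoly-cong (_-Raw-AlmostCommutative⟶_.0-homo ℤ↦ℤ[q])
    ; 1-homo = ≋L-refl }

module LaurentPolynomials where
  open PolynomialRing
  open PolynomialFacts
  open LaurentRing
  open PolySolver using (_:*_; con; _:=_; solve)

  -- Opaque, so that comparing ring elements never unfolds the proofs inside the ring structure.
  opaque
    ℤ[q,q⁻¹] : CommutativeRing 0ℓ 0ℓ
    ℤ[q,q⁻¹] = laurentRing

  opaque
    unfolding ℤ[q,q⁻¹]
    ℤ↦ℤ[q,q⁻¹] : ℤ-Algebra ℤ[q,q⁻¹]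
    -- copied field by field: using ℤ↦laurentRing directly makes Agda normalise the whole ring
    ℤ↦ℤ[q,q⁻¹] = record
      { ⟦_⟧    = ⟦_⟧
      ; +-homo = +-homo
      ; *-homo = *-homo
      ; -‿homo = -‿homo
      ; 0-homo = 0-homo
      ; 1-homo = 1-homo }
      where open _-Raw-AlmostCommutative⟶_ ℤ↦laurentRing

  open CommutativeRingFacts ℤ[q,q⁻¹] ℤ↦ℤ[q,q⁻¹] public
    hiding (solve; _:+_; _:*_; _:-_; :-_; _:=_)

  opaque
    unfolding ℤ[q,q⁻¹] ℤ↦ℤ[q,q⁻¹]

    fromLaurent : Laurent → Carrier
    fromLaurent A = A

    poly : Poly → Carrier
    poly = fromPoly

    q : Carrier
    q = poly (X^ 1)

    q⁻¹ : Carrier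
    q⁻¹ = oneP /q^ 1

    q*q⁻¹≈1 : q * q⁻¹ ≈ 1#
    q*q⁻¹≈1 = mk≋L (*P-identityˡ (X^ 1 *P oneP))

    poly-*P : ∀ p r → poly (p *P r) ≈ poly p * poly r
    poly-*P p r = ≋L-refl

    poly-+P : ∀ p r → poly (p +P r) ≈ poly p + poly r
    poly-+P p r = fromPoly-cong (≋-sym (+P-cong (*P-identityˡ p) (*P-identityˡ r)))

    poly-cong : ∀ {p r} → p ≋ r → poly p ≈ poly r
    poly-cong = fromPoly-cong

    poly-oneP : poly oneP ≈ 1#
    poly-oneP = ≋L-refl

    poly-X^1 : poly (X^ 1) ≈ q
    poly-X^1 = ≋L-refl

    poly-constP : ∀ a → poly (constP a) ≈ ⟦ a ⟧
    poly-constP a = ≋L-refl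

    poly-negP : ∀ p → poly (negP p) ≈ - poly p
    poly-negP p = ≋L-refl

    fromLaurent-+L : ∀ A B → fromLaurent (A +L B) ≡ fromLaurent A + fromLaurent B
    fromLaurent-+L A B = refl

    fromLaurent-*L : ∀ A B → fromLaurent (A *L B) ≡ fromLaurent A * fromLaurent B
    fromLaurent-*L A B = refl

    fromLaurent-zeroL : fromLaurent zeroL ≡ 0#
    fromLaurent-zeroL = refl

    fromLaurent-fromPoly : ∀ p → fromLaurent (fromPoly p) ≡ poly p
    fromLaurent-fromPoly p = refl

    q⁻¹^k≈1/q^k : ∀ k → q⁻¹ ^ k ≈ fromLaurent (oneP /q^ k)
    q⁻¹^k≈1/q^k zero    = ≋L-refl
    q⁻¹^k≈1/q^k (suc k) = ≋L-trans (*-congˡ {q⁻¹} (q⁻¹^k≈1/q^k k))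
      (mk≋L (solve 1 (λ X → X :* (con 1ℤ :* con 1ℤ) := X :* con 1ℤ) ≋-refl (X^ (suc k))))

    fromLaurent-monoL-neg : ∀ a m → fromLaurent (monoL a -[1+ m ]) ≈ ⟦ a ⟧ * q⁻¹ ^ suc m
    fromLaurent-monoL-neg a m = ≋L-sym (≋L-trans (*-congˡ {⟦ a ⟧} (q⁻¹^k≈1/q^k (suc m)))
      (mk≋L (solve 2 (λ X A → X :* (A :* con 1ℤ) := X :* A) ≋-refl (X^ (suc m)) (constP a))))

    fromLaurent-monoL-pos : ∀ a m → fromLaurent (monoL a (+ m)) ≈ ⟦ a ⟧ * poly (X^ m)
    fromLaurent-monoL-pos a m = fromPoly-cong (≋-sym (constP-*P a (X^ m)))

    ∣⇒∣L : ∀ A B → fromLaurent A ∣ fromLaurent B → A ∣L B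
    ∣⇒∣L A B (C , C*A≈B) = C , cross-≋ (≋L-trans (*L-comm A C) C*A≈B) .coeff-≡

    poly-cancel-zero : ∀ {A} x → UnitConstant A → poly A * x ≈ 0# → x ≈ 0#
    poly-cancel-zero {A} (y /q^ m) unit (mk≋L e) =
      mk≋L (≋-trans (*P-identityˡ y) (≋-trans y≋[] (≋-sym (*P-zeroʳ (X^ m)))))
      where
      Ay≋[] : (A *P y) ≋ []
      Ay≋[] = ≋-trans (≋-sym (*P-identityˡ _)) (≋-trans e (*P-zeroʳ (X^ m)))
      0∣⇒≡0 : ∀ {z} → 0ℤ ZS.∣ z → z ≡ 0ℤ
      0∣⇒≡0 (ZS.divides t z≡t*0) = ≡.trans z≡t*0 (ℤP.*-zeroʳ t)
      y≋[] : y ≋ []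
      y≋[] = mk≋ λ i → 0∣⇒≡0 (∣Coeffs-cancelˡ A y 0ℤ unit
        (λ j → ≡.subst (0ℤ ZS.∣_) (≡.sym (coeff-≡ Ay≋[] j)) (ZS.divides 0ℤ refl)) i)

    poly-∣-cancel-ℤ : ∀ {A x} N → UnitConstant A → N ≢ 0ℤ → poly A ∣ ⟦ N ⟧ * x → poly A ∣ x
    poly-∣-cancel-ℤ {A} {x} N unit N≢0 (c , c*A≈Nx) = divides x c (≋L-trans (*L-comm (poly A) c) c*A≈Nx)
      where
      divides : ∀ x c → poly A * c ≈ ⟦ N ⟧ * x → poly A ∣ x
      divides (y /q^ m) (cp /q^ k) (mk≋L e) = (Q' /q^ (m ℕ.+ k)) , ≋L-trans (*L-comm (Q' /q^ (m ℕ.+ k)) (poly A)) (mk≋L AQ'≋y)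
        where
        Q : Poly
        Q = X^ m *P cp
        Z : Poly
        Z = X^ k *P y
        AQ≋NZ : (A *P Q) ≋ (constP N *P Z)
        AQ≋NZ = ≋-trans (solve 3 (λ A M C → A :* (M :* C) := M :* (A :* C)) ≋-refl A (X^ m) cp)
                  (≋-trans e (solve 3 (λ K B Y → K :* (B :* Y) := B :* (K :* Y)) ≋-refl (X^ k) (constP N) y))
        Q≋NQ' : Σ Poly λ Q' → Q ≋ scaleP N Q'
        Q≋NQ' = ∣Coeffs⇒scaleP Q N (∣Coeffs-cancelˡ A Q N unit λ i →
          ≡.subst (N ZS.∣_) (≡.sym (≡.trans (coeff-≡ AQ≋NZ i)
                                     (≡.trans (coeff-≡ (constP-*P N Z) i) (coeff-scaleP N Z i))))
                  (ZS.∣m⇒∣m*n (coeff Z i) (ZS.∣-refl {N})))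
        Q' : Poly
        Q' = proj₁ Q≋NQ'
        AQ'≋Z : (A *P Q') ≋ Z
        AQ'≋Z = scaleP-cancel N N≢0 (≋-trans (≋-sym (constP-*P N _))
          (≋-trans (solve 3 (λ B A Q → B :* (A :* Q) := A :* (B :* Q)) ≋-refl (constP N) A Q')
          (≋-trans (*P-congˡ A (≋-trans (constP-*P N Q') (≋-sym (proj₂ Q≋NQ')))) (≋-trans AQ≋NZ (constP-*P N Z)))))
        AQ'≋y : (X^ m *P (A *P Q')) ≋ (X^ (m ℕ.+ k) *P y)
        AQ'≋y = ≋-trans (*P-congˡ (X^ m) AQ'≋Z)
          (≋-sym (≋-trans (X^-*P-+ m k y) (solve 3 (λ M K Y → M :* K :* Y := M :* (K :* Y)) ≋-refl (X^ m) (X^ k) y)))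

module UnitConstantsAndCoprimality where
  open PolynomialFacts
  open LaurentPolynomials
  open ℤ-Solver ℤ[q,q⁻¹] ℤ↦ℤ[q,q⁻¹] using (solve; _:+_; _:*_; _:-_; _:=_)

  HasUnitConstant : Carrier → Set
  HasUnitConstant a = Σ Poly λ A → UnitConstant A × a ≈ poly A

  unitConstant-cancelˡ : ∀ {a x y} → HasUnitConstant a → a * x ≈ a * y → x ≈ y
  unitConstant-cancelˡ {a} {x} {y} (A , unit , a≈A) ax≈ay = begin
    x             ≈⟨ solve 2 (λ X Y → X := (X :- Y) :+ Y) ≈-refl x y ⟩
    (x - y) + y   ≈⟨ +-congʳ (poly-cancel-zero (x - y) unit A[x-y]≈0) ⟩
    0# + y        ≈⟨ +-identityˡ y ⟩
    y             ∎
    where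
    A[x-y]≈0 : poly A * (x - y) ≈ 0#
    A[x-y]≈0 = ≈-trans (*-congʳ (≈-sym a≈A))
      (≈-trans (solve 3 (λ A X Y → A :* (X :- Y) := A :* X :- A :* Y) ≈-refl a x y)
               (≈-trans (+-congʳ ax≈ay) (-‿inverseʳ _)))

  unitConstant-∣-cancel-ℤ : ∀ {a x} N → HasUnitConstant a → N ≢ 0ℤ → a ∣ ⟦ N ⟧ * x → a ∣ x
  unitConstant-∣-cancel-ℤ N (A , unit , a≈A) N≢0 a∣Nx =
    ∣ʳ-respˡ-≈ (≈-sym a≈A) (poly-∣-cancel-ℤ N unit N≢0 (∣ʳ-respˡ-≈ a≈A a∣Nx))

  unitConstant-* : ∀ {a b} → HasUnitConstant a → HasUnitConstant b → HasUnitConstant (a * b)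
  unitConstant-* (A , unitA , a≈A) (B , unitB , b≈B) =
    (A *P B) , unitConstant-*P A B unitA unitB ,
    ≈-trans (*-cong a≈A b≈B) (≈-sym (poly-*P A B))

  unitConstant-1 : HasUnitConstant 1#
  unitConstant-1 = oneP , refl , ≈-sym poly-oneP

  unitConstant-^ : ∀ {a} k → HasUnitConstant a → HasUnitConstant (a ^ k)
  unitConstant-^ zero    _ = unitConstant-1
  unitConstant-^ (suc k) a = unitConstant-* a (unitConstant-^ k a)

  -- coprimality in ℚ[q,q⁻¹], with the denominator cleared
  RationallyCoprime : Carrier → Carrier → Set
  RationallyCoprime a b = Σ Carrier λ u → Σ Carrier λ v → Σ ℤ λ N → N ≢ 0ℤ × u * a + v * b ≈ ⟦ N ⟧

  coprime-sym : ∀ {a b} → RationallyCoprime a b → RationallyCoprime b a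
  coprime-sym (u , v , N , N≢0 , e) = v , u , N , N≢0 , ≈-trans (+-comm _ _) e

  coprime-*ʳ : ∀ {a b b'} → RationallyCoprime a b → RationallyCoprime a b' → RationallyCoprime a (b * b')
  coprime-*ʳ {a} {b} {b'} (u , v , N , N≢0 , e) (u' , v' , N' , N'≢0 , e') =
    (u * u' * a + u * v' * b' + v * b * u') , v * v' , N ℤ.* N' , N*N'≢0 ,
    ≈-trans (solve 7 (λ A B B' U V U' V' →
               (U :* U' :* A :+ U :* V' :* B' :+ V :* B :* U') :* A :+ V :* V' :* (B :* B')
               := (U :* A :+ V :* B) :* (U' :* A :+ V' :* B')) ≈-refl a b b' u v u' v')
            (≈-trans (*-cong e e') (≈-sym (⟦*⟧≈* N N')))
    where
    N*N'≢0 : N ℤ.* N' ≢ 0ℤ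
    N*N'≢0 NN'≡0 = [ N≢0 , N'≢0 ]′ (ℤP.i*j≡0⇒i≡0∨j≡0 N NN'≡0)

  coprime-1 : ∀ {a} → RationallyCoprime a 1#
  coprime-1 {a} = 0# , 1# , 1ℤ , (λ ()) ,
    ≈-trans (+-cong (zeroˡ a) (*-identityˡ 1#)) (≈-trans (+-identityˡ 1#) (≈-sym ⟦1⟧≈1))

  coprime-^ʳ : ∀ {a b} k → RationallyCoprime a b → RationallyCoprime a (b ^ k)
  coprime-^ʳ zero    _   = coprime-1
  coprime-^ʳ (suc k) a⊥b = coprime-*ʳ a⊥b (coprime-^ʳ k a⊥b)

  coprime-^ : ∀ {a b} k l → RationallyCoprime a b → RationallyCoprime (a ^ k) (b ^ l)
  coprime-^ k l a⊥b = coprime-sym (coprime-^ʳ k (coprime-sym (coprime-^ʳ l a⊥b)))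

  coprime-∣ʳ : ∀ {a b b'} → RationallyCoprime a b → b' ∣ b → RationallyCoprime a b'
  coprime-∣ʳ {a} {b} {b'} (u , v , N , N≢0 , e) (t , tb'≈b) =
    u , v * t , N , N≢0 , ≈-trans (+-congˡ (≈-trans (*-assoc v t b') (*-congˡ tb'≈b))) e

  coprime-combination : ∀ {a b c} α β → RationallyCoprime a c → c ≈ a * α + b * β → RationallyCoprime a b
  coprime-combination {a} {b} {c} α β (u , v , N , N≢0 , e) c≈aα+bβ = (u + v * α) , v * β , N , N≢0 ,
    ≈-trans (solve 6 (λ U V A Al B Be → (U :+ V :* Al) :* A :+ V :* Be :* B := U :* A :+ V :* (A :* Al :+ B :* Be))
                     ≈-refl u v a α b β)
            (≈-trans (+-congˡ (*-congˡ (≈-sym c≈aα+bβ))) e)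

  coprime-∣-cancel : ∀ {a b x} → RationallyCoprime a b → HasUnitConstant a → a ∣ b * x → a ∣ x
  coprime-∣-cancel {a} {b} {x} (u , v , N , N≢0 , e) unit a∣bx = unitConstant-∣-cancel-ℤ N unit N≢0
    (∣ʳ-respʳ-≈ Nx (∣x∣y⇒∣x+y (x∣ʳy⇒x∣ʳzy u (∣x⇒∣x*y x ∣ʳ-refl)) (x∣ʳy⇒x∣ʳzy v a∣bx)))
    where
    Nx : u * (a * x) + v * (b * x) ≈ ⟦ N ⟧ * x
    Nx = ≈-trans (solve 5 (λ U A X V B → U :* (A :* X) :+ V :* (B :* X) := (U :* A :+ V :* B) :* X) ≈-refl u a x v b)
                 (*-congʳ e)

  coprime-∣-* : ∀ {a b x} → RationallyCoprime a b → HasUnitConstant (a * b) → a ∣ x → b ∣ x → a * b ∣ x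
  coprime-∣-* {a} {b} {x} (u , v , N , N≢0 , e) unit (s , sa≈x) (t , tb≈x) =
    unitConstant-∣-cancel-ℤ N unit N≢0 (u * t + v * s , (begin
      (u * t + v * s) * (a * b)     ≈⟨ solve 6 (λ U T V S A B → (U :* T :+ V :* S) :* (A :* B)
                                                  := U :* A :* (T :* B) :+ V :* B :* (S :* A)) ≈-refl u t v s a b ⟩
      u * a * (t * b) + v * b * (s * a) ≈⟨ +-cong (*-congˡ tb≈x) (*-congˡ sa≈x) ⟩
      u * a * x + v * b * x         ≈⟨ distribʳ x _ _ ⟨
      (u * a + v * b) * x           ≈⟨ *-congʳ e ⟩
      ⟦ N ⟧ * x                     ∎))

module Decoding where
  open PolynomialRing
  open PolynomialFacts
  open LaurentPolynomials
  open GaussianBinomials ℤ[q,q⁻¹] ℤ↦ℤ[q,q⁻¹] q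

  poly-prodP : ∀ ps → poly (prodP ps) ≈ foldr _*_ 1# (map poly ps)
  poly-prodP []       = poly-oneP
  poly-prodP (p ∷ ps) = ≈-trans (poly-*P p (prodP ps)) (*-congˡ (poly-prodP ps))

  poly-prodP-map : ∀ (G : ℕ → Poly) xs → poly (prodP (map G xs)) ≈ foldr _*_ 1# (map (λ x → poly (G x)) xs)
  poly-prodP-map G xs = ≈-trans (poly-prodP (map G xs)) (reflexive (≡.cong (foldr _*_ 1#) (≡.sym (LP.map-∘ xs))))

  poly-prodP-upTo : ∀ (G : ℕ → Poly) n → poly (prodP (map G (upTo n))) ≈ ∏ n (λ i → poly (G i))
  poly-prodP-upTo G n = ≈-trans (poly-prodP-map G (upTo n)) (product-upTo _ n)

  poly-prodP-filter-upTo : ∀ (G : ℕ → Poly) (s : ℕ → ℕ) {P : Pred ℕ 0ℓ} (P? : Decidable P) n →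
    poly (prodP (map G (filter P? (map s (upTo n))))) ≈ ∏ n (λ i → if does (P? (s i)) then poly (G (s i)) else 1#)
  poly-prodP-filter-upTo G s P? n =
    ≈-trans (poly-prodP-map G (filter P? (map s (upTo n)))) (product-filter-upTo (λ x → poly (G x)) s P? n)

  poly-X^ : ∀ d → poly (X^ d) ≈ q ^ d
  poly-X^ zero    = poly-oneP
  poly-X^ (suc d) = ≈-trans (poly-cong (≋-sym (X^1-*P (X^ d))))
                      (≈-trans (poly-*P _ _) (*-cong poly-X^1 (poly-X^ d)))

  poly-q^−1 : ∀ d → poly (X^ d -P oneP) ≈ q^ d −1
  poly-q^−1 d = ≈-trans (poly-+P _ _) (+-cong (poly-X^ d) (≈-trans (poly-negP oneP) (-‿cong poly-oneP)))

  poly-qint : ∀ m → poly (qint m) ≈ [ m ]q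
  poly-qint zero    = ≈-trans (poly-cong []≋0) (≈-trans (poly-constP 0ℤ) ⟦0⟧≈0)
  poly-qint (suc m) = ≈-trans (poly-cong (≋-sym (+P-cong (≋-refl {oneP}) (X^1-*P (qint m)))))
    (≈-trans (poly-+P oneP _) (+-cong poly-oneP (≈-trans (poly-*P (X^ 1) _) (*-cong poly-X^1 (poly-qint m)))))

  poly-^P : ∀ p m → poly (p ^P m) ≈ poly p ^ m
  poly-^P p zero    = poly-oneP
  poly-^P p (suc m) = ≈-trans (poly-*P p _) (*-congˡ (poly-^P p m))

  open UnitPowers q*q⁻¹≈1 public

  fromLaurent-monoL : ∀ a z → fromLaurent (monoL a z) ≈ ⟦ a ⟧ * pow z
  fromLaurent-monoL a (+ m)    = ≈-trans (fromLaurent-monoL-pos a m) (*-congˡ (poly-X^ m))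
  fromLaurent-monoL a -[1+ m ] = fromLaurent-monoL-neg a m

  fromLaurent-sumL : ∀ xs → fromLaurent (sumL xs) ≡ foldr _+_ 0# (map fromLaurent xs)
  fromLaurent-sumL []       = fromLaurent-zeroL
  fromLaurent-sumL (x ∷ xs) = ≡.trans (fromLaurent-+L x (sumL xs)) (≡.cong (λ z → fromLaurent x + z) (fromLaurent-sumL xs))

  ⟦sgn⟧≈sign : ∀ k → ⟦ sgn k ⟧ ≈ sign k
  ⟦sgn⟧≈sign zero    = ⟦1⟧≈1
  ⟦sgn⟧≈sign (suc k) = ≈-trans (⟦-⟧≈- (sgn k)) (≈-trans (-‿cong (⟦sgn⟧≈sign k)) (≈-sym (-1*x≈-x (sign k))))

module GaussianBinomialsOverℤ[q,q⁻¹] where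
  open LaurentPolynomials
  open ℤ-Solver ℤ[q,q⁻¹] ℤ↦ℤ[q,q⁻¹] using (solve; _:*_; _:=_)
  open GaussianBinomials ℤ[q,q⁻¹] ℤ↦ℤ[q,q⁻¹] q
  open UnitConstantsAndCoprimality
  open Decoding

  [k]q!-unitConstant : ∀ k → HasUnitConstant [ k ]q!
  [k]q!-unitConstant zero    = unitConstant-1
  [k]q!-unitConstant (suc k) = unitConstant-* ([k]q!-unitConstant k) (qint (suc k) , refl , ≈-sym (poly-qint (suc k)))

  qBinomial-absorption : ∀ d j → qBinomial (suc d) (suc j) * [ suc j ]q ≈ [ suc d ]q * qBinomial d j
  qBinomial-absorption d j = unitConstant-cancelˡ ([k]q!-unitConstant j) (begin
    [ j ]q! * (qBinomial (suc d) (suc j) * [ suc j ]q)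
      ≈⟨ solve 3 (λ A G N → A :* (G :* N) := G :* (A :* N)) ≈-refl [ j ]q! (qBinomial (suc d) (suc j)) [ suc j ]q ⟩
    qBinomial (suc d) (suc j) * [ suc j ]q!  ≈⟨ qBinomial*[k]q!≈qFalling (suc d) (suc j) ⟩
    qFalling (suc d) (suc j)                  ≈⟨ qFalling-suc d j ⟩
    [ suc d ]q * qFalling d j                 ≈⟨ *-congˡ (qBinomial*[k]q!≈qFalling d j) ⟨
    [ suc d ]q * (qBinomial d j * [ j ]q!)
      ≈⟨ solve 3 (λ N G A → N :* (G :* A) := A :* (N :* G)) ≈-refl [ suc d ]q (qBinomial d j) [ j ]q! ⟩
    [ j ]q! * ([ suc d ]q * qBinomial d j)    ∎)

  qBinomial-absorption-q^−1 : ∀ d j → qBinomial (suc d) (suc j) * q^ suc j −1 ≈ q^ suc d −1 * qBinomial d j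
  qBinomial-absorption-q^−1 d j = begin
    qBinomial (suc d) (suc j) * q^ suc j −1            ≈⟨ *-congˡ ([q-1]*[m]q≈q^m-1 (suc j)) ⟨
    qBinomial (suc d) (suc j) * ((q - 1#) * [ suc j ]q)
      ≈⟨ solve 3 (λ G A N → G :* (A :* N) := A :* (G :* N)) ≈-refl (qBinomial (suc d) (suc j)) (q - 1#) [ suc j ]q ⟩
    (q - 1#) * (qBinomial (suc d) (suc j) * [ suc j ]q) ≈⟨ *-congˡ (qBinomial-absorption d j) ⟩
    (q - 1#) * ([ suc d ]q * qBinomial d j)             ≈⟨ *-assoc _ _ _ ⟨
    (q - 1#) * [ suc d ]q * qBinomial d j               ≈⟨ *-congʳ ([q-1]*[m]q≈q^m-1 (suc d)) ⟩
    q^ suc d −1 * qBinomial d j                         ∎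

  poly-gaussianFamily : ∀ {n B} → IsGaussianFamily n B → ∀ k → k ≤ n → poly (B k) ≈ qBinomial n k
  poly-gaussianFamily {n} {B} isGaussian k k≤n = unitConstant-cancelˡ ([k]q!-unitConstant k) (begin
    [ k ]q! * poly (B k)                ≈⟨ *-comm _ _ ⟩
    poly (B k) * [ k ]q!                ≈⟨ *-congˡ (∏-cong k (λ i _ → poly-qint (suc i))) ⟨
    poly (B k) * ∏ k (λ i → poly (qint (suc i)))
                                        ≈⟨ *-congˡ (poly-prodP-upTo (λ i → qint (suc i)) k) ⟨
    poly (B k) * poly (prodP (map (λ i → qint (suc i)) (upTo k)))
      ≈⟨ poly-*P _ _ ⟨
    poly (B k *P prodP (map (λ i → qint (suc i)) (upTo k)))
      ≈⟨ poly-cong (PolynomialRing.mk≋ (isGaussian k k≤n)) ⟩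
    poly (prodP (map (λ i → qint (n ∸ i)) (upTo k)))
      ≈⟨ poly-prodP-upTo (λ i → qint (n ∸ i)) k ⟩
    ∏ k (λ i → poly (qint (n ∸ i)))     ≈⟨ ∏-cong k (λ i _ → poly-qint (n ∸ i)) ⟩
    qFalling n k                        ≈⟨ qBinomial*[k]q!≈qFalling n k ⟨
    qBinomial n k * [ k ]q!             ≈⟨ *-comm _ _ ⟩
    [ k ]q! * qBinomial n k             ∎)

module CyclotomicValues (Φ : ℕ → Poly) (isCyclotomic : IsCyclotomicFamily Φ) where
  open PolynomialRing using (mk≋)
  open PolynomialFacts
  open LaurentPolynomials
  open ℤ-Solver ℤ[q,q⁻¹] ℤ↦ℤ[q,q⁻¹] using (solve; _:+_; _:*_; _:-_; :-_; _:=_)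
  open GaussianBinomials ℤ[q,q⁻¹] ℤ↦ℤ[q,q⁻¹] q
  open UnitConstantsAndCoprimality
  open Decoding
  open GaussianBinomialsOverℤ[q,q⁻¹]

  φ : ℕ → Carrier
  φ d = poly (Φ d)

  _∣ᵇ_ : ℕ → ℕ → Bool
  e ∣ᵇ d = does (e ∣? d)

  q^d−1≈∏φ : ∀ d → 1 ≤ d → q^ d −1 ≈ filteredProduct d (_∣ᵇ d) φ
  q^d−1≈∏φ d 1≤d = ≈-trans (≈-sym (poly-q^−1 d))
    (≈-trans (poly-cong (mk≋ λ i → ≡.sym (isCyclotomic d 1≤d i))) (poly-prodP-filter-upTo Φ suc (_∣? d) d))

  φ∣q^d−1 : ∀ d → 1 ≤ d → φ d ∣ q^ d −1
  φ∣q^d−1 d 1≤d = ∣ʳ-respʳ-≈ (≈-sym (q^d−1≈∏φ d 1≤d))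
    (∣-filteredProduct d (_∣ᵇ d) φ d 1≤d ℕP.≤-refl (dec-true (d ∣? d) ℕD.∣-refl))

  φ-unitConstant : ∀ d → 1 ≤ d → HasUnitConstant (φ d)
  φ-unitConstant (suc d) 1≤d = Φ (suc d) , unitConstant-∈-prodP _ Φ[d]∈ constant≡-1 , ≈-refl
    where
    Φ[d]∈ : Φ (suc d) ∈ map Φ (filter (_∣? suc d) (map suc (upTo (suc d))))
    Φ[d]∈ = ∈-map⁺ Φ (∈-filter⁺ (_∣? suc d) (∈-map⁺ suc (∈-upTo⁺ (ℕP.n<1+n d))) ℕD.∣-refl)
    constant≡-1 : UnitConstant (prodP (map Φ (filter (_∣? suc d) (map suc (upTo (suc d))))))
    constant≡-1 = ≡.subst IsUnitℤ (≡.sym (isCyclotomic (suc d) 1≤d 0)) refl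

  q^d−1-unitConstant : ∀ d → 1 ≤ d → HasUnitConstant (q^ d −1)
  q^d−1-unitConstant (suc d) _ = (X^ (suc d) -P oneP) , refl , ≈-sym (poly-q^−1 (suc d))

  -- q^d - 1 = ∏_{e ∣ d} Φ_e: the factors with e ∣ g give q^g - 1, and Φ_d is among the others.
  q^d−1-factor : ∀ g d → 1 ≤ g → g < d → g ℕD.∣ d → Σ Carrier λ R → q^ d −1 ≈ q^ g −1 * R × φ d ∣ R
  q^d−1-factor g d 1≤g g<d g∣d = rest , (begin
    q^ d −1                           ≈⟨ q^d−1≈∏φ d 1≤d ⟩
    filteredProduct d (_∣ᵇ d) φ       ≈⟨ filteredProduct-split d (_∣ᵇ d) (_∣ᵇ g) φ ⟩
    filteredProduct d (λ e → e ∣ᵇ d ∧ e ∣ᵇ g) φ * rest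
      ≈⟨ *-congʳ (filteredProduct-cong d _ (_∣ᵇ g) φ λ e _ _ → ∣ᵇ-∧ e) ⟩
    filteredProduct d (_∣ᵇ g) φ * rest
      ≈⟨ *-congʳ (filteredProduct-truncate g d (_∣ᵇ g) φ (ℕP.<⇒≤ g<d) λ e g<e _ → ∣ᵇ-large e g<e) ⟩
    filteredProduct g (_∣ᵇ g) φ * rest ≈⟨ *-congʳ (≈-sym (q^d−1≈∏φ g 1≤g)) ⟩
    q^ g −1 * rest                    ∎) , φ∣rest
    where
    1≤d : 1 ≤ d
    1≤d = ℕP.≤-trans 1≤g (ℕP.<⇒≤ g<d)
    rest : Carrier
    rest = filteredProduct d (λ e → e ∣ᵇ d ∧ not (e ∣ᵇ g)) φ
    ∣ᵇ-∧ : ∀ e → (e ∣ᵇ d ∧ e ∣ᵇ g) ≡ e ∣ᵇ g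
    ∣ᵇ-∧ e with e ∣? d | e ∣? g
    ... | yes _   | yes _   = refl
    ... | yes _   | no _    = refl
    ... | no e∤d  | yes e∣g = ⊥-elim (e∤d (ℕD.∣-trans e∣g g∣d))
    ... | no _    | no _    = refl
    ∣ᵇ-large : ∀ e → g < e → e ∣ᵇ g ≡ false
    ∣ᵇ-large e g<e = dec-false (e ∣? g) λ e∣g → ℕP.<⇒≱ g<e (ℕD.∣⇒≤ {{ℕ.>-nonZero 1≤g}} e∣g)
    φ∣rest : φ d ∣ rest
    φ∣rest = ∣-filteredProduct d (λ e → e ∣ᵇ d ∧ not (e ∣ᵇ g)) φ d 1≤d ℕP.≤-refl
      (≡.cong₂ _∧_ (dec-true (d ∣? d) ℕD.∣-refl) (≡.cong not (∣ᵇ-large d g<d)))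

  -- Φ_d(q) divides (q^d - 1)/(q^g - 1) = 1 + q^g + ⋯ + q^{g(t-1)}, which is t modulo q^g - 1.
  coprime-φ-q^g−1 : ∀ g d → 1 ≤ g → g < d → g ℕD.∣ d → RationallyCoprime (φ d) (q^ g −1)
  coprime-φ-q^g−1 g d 1≤g g<d g∣d@(ℕD.divides t d≡t*g) with q^d−1-factor g d 1≤g g<d g∣d
  ... | R , q^d−1≈q^g−1*R , (W , Wφ≈R) = W , - H , + t , t≢0 , (begin
      W * φ d + - H * q^ g −1         ≈⟨ solve 4 (λ W F H E → W :* F :+ (:- H) :* E := W :* F :- E :* H) ≈-refl W (φ d) H (q^ g −1) ⟩
      W * φ d - q^ g −1 * H           ≈⟨ +-congʳ (≈-trans Wφ≈geometric (geometric≈k+[x-1]*∑geometric (q ^ g) t)) ⟩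
      (⟦ + t ⟧ + q^ g −1 * H) - q^ g −1 * H ≈⟨ solve 2 (λ T X → (T :+ X) :- X := T) ≈-refl ⟦ + t ⟧ (q^ g −1 * H) ⟩
      ⟦ + t ⟧                         ∎)
    where
    H : Carrier
    H = ∑ t (geometric (q ^ g))
    Wφ≈geometric : W * φ d ≈ geometric (q ^ g) t
    Wφ≈geometric = unitConstant-cancelˡ (q^d−1-unitConstant g 1≤g) (≈-trans (*-congˡ Wφ≈R) (≈-trans
      (≈-sym q^d−1≈q^g−1*R)
      (≡.subst (λ m → q^ m −1 ≈ q^ g −1 * geometric (q ^ g) t) (≡.trans (ℕP.*-comm g t) (≡.sym d≡t*g)) (q^[m*k]−1 g t))))
    t≢0 : + t ≢ 0ℤ
    t≢0 t≡0 = ℕP.<⇒≢ (ℕP.≤-trans 1≤g (ℕP.<⇒≤ g<d))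
      (≡.sym (≡.trans d≡t*g (≡.cong (ℕ._* g) (ℤP.+-injective t≡0))))

  q^g−1≈difference : ∀ g b → q^ g −1 ≈ q^ (g ℕ.+ b) −1 - q ^ g * q^ b −1
  q^g−1≈difference g b = ≈-trans
    (solve 3 (λ A B C → C := (A :* B :+ C) :- A :* B) ≈-refl (q ^ g) (q^ b −1) (q^ g −1))
    (+-congʳ (≈-sym (q^[a+b]−1 g b)))

  -- By Bézout, gcd(d, m) is a ℕ-combination of d and m, so q^gcd(d,m) - 1 lies in the ideal
  -- generated by q^d - 1 and q^m - 1.
  q^gcd−1∈⟨φ,q^m−1⟩ : ∀ d m → 1 ≤ d → Σ Carrier λ α → Σ Carrier λ β → q^ (gcd d m) −1 ≈ φ d * α + q^ m −1 * β
  q^gcd−1∈⟨φ,q^m−1⟩ d m 1≤d with φ∣q^d−1 d 1≤d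
  ... | s , sφ≈q^d−1 = from-bézout (Bézout.identity (gcd-GCD d m))
    where
    g : ℕ
    g = gcd d m
    q^[x*d]−1 : ∀ x → q^ (x ℕ.* d) −1 ≈ φ d * (s * geometric (q ^ d) x)
    q^[x*d]−1 x = ≈-trans (≡.subst (λ z → q^ z −1 ≈ q^ d −1 * geometric (q ^ d) x) (ℕP.*-comm d x) (q^[m*k]−1 d x))
      (≈-trans (*-congʳ (≈-sym sφ≈q^d−1))
               (solve 3 (λ S F G → (S :* F) :* G := F :* (S :* G)) ≈-refl s (φ d) _))
    q^[y*m]−1 : ∀ y → q^ (y ℕ.* m) −1 ≈ q^ m −1 * geometric (q ^ m) y
    q^[y*m]−1 y = ≡.subst (λ z → q^ z −1 ≈ q^ m −1 * geometric (q ^ m) y) (ℕP.*-comm m y) (q^[m*k]−1 m y)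
    from-bézout : Bézout.Identity g d m → Σ Carrier λ α → Σ Carrier λ β → q^ g −1 ≈ φ d * α + q^ m −1 * β
    from-bézout (Bézout.+- x y g+ym≡xd) = s * geometric (q ^ d) x , - (q ^ g * geometric (q ^ m) y) , (begin
      q^ g −1                                                ≈⟨ q^g−1≈difference g (y ℕ.* m) ⟩
      q^ (g ℕ.+ y ℕ.* m) −1 - q ^ g * q^ (y ℕ.* m) −1
        ≈⟨ +-cong (≡.subst (λ z → q^ z −1 ≈ φ d * (s * geometric (q ^ d) x)) (≡.sym g+ym≡xd) (q^[x*d]−1 x))
                  (-‿cong (*-congˡ (q^[y*m]−1 y))) ⟩
      φ d * (s * geometric (q ^ d) x) - q ^ g * (q^ m −1 * geometric (q ^ m) y)
        ≈⟨ solve 5 (λ F A Q E B → F :* A :- Q :* (E :* B) := F :* A :+ E :* (:- (Q :* B))) ≈-refl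
                 (φ d) (s * geometric (q ^ d) x) (q ^ g) (q^ m −1) (geometric (q ^ m) y) ⟩
      φ d * (s * geometric (q ^ d) x) + q^ m −1 * - (q ^ g * geometric (q ^ m) y) ∎)
    from-bézout (Bézout.-+ x y g+xd≡ym) = - (q ^ g * (s * geometric (q ^ d) x)) , geometric (q ^ m) y , (begin
      q^ g −1                                                ≈⟨ q^g−1≈difference g (x ℕ.* d) ⟩
      q^ (g ℕ.+ x ℕ.* d) −1 - q ^ g * q^ (x ℕ.* d) −1
        ≈⟨ +-cong (≡.subst (λ z → q^ z −1 ≈ q^ m −1 * geometric (q ^ m) y) (≡.sym g+xd≡ym) (q^[y*m]−1 y))
                  (-‿cong (*-congˡ (q^[x*d]−1 x))) ⟩
      q^ m −1 * geometric (q ^ m) y - q ^ g * (φ d * (s * geometric (q ^ d) x))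
        ≈⟨ solve 5 (λ F A Q E B → E :* B :- Q :* (F :* A) := F :* (:- (Q :* A)) :+ E :* B) ≈-refl
                 (φ d) (s * geometric (q ^ d) x) (q ^ g) (q^ m −1) (geometric (q ^ m) y) ⟩
      φ d * - (q ^ g * (s * geometric (q ^ d) x)) + q^ m −1 * geometric (q ^ m) y ∎)

  coprime-φ-q^m−1 : ∀ d m → 1 ≤ d → ¬ d ℕD.∣ m → RationallyCoprime (φ d) (q^ m −1)
  coprime-φ-q^m−1 d m 1≤d d∤m with q^gcd−1∈⟨φ,q^m−1⟩ d m 1≤d
  ... | α , β , q^g−1≈φα+q^m−1β =
    coprime-combination α β (coprime-φ-q^g−1 g d 1≤g g<d (gcd[m,n]∣m d m)) q^g−1≈φα+q^m−1β
    where
    g : ℕ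
    g = gcd d m
    1≤g : 1 ≤ g
    1≤g = ℕP.n≢0⇒n>0 (gcd[m,n]≢0 d m (inj₁ (ℕP.n>0⇒n≢0 1≤d)))
    g<d : g < d
    g<d with ℕP.m≤n⇒m<n∨m≡n (ℕD.∣⇒≤ {{ℕ.>-nonZero 1≤d}} (gcd[m,n]∣m d m))
    ... | inj₁ g<d = g<d
    ... | inj₂ g≡d = ⊥-elim (d∤m (≡.subst (ℕD._∣ m) g≡d (gcd[m,n]∣n d m)))

  coprime-φ-φ : ∀ d e → 1 ≤ d → 1 ≤ e → d ≢ e → RationallyCoprime (φ d) (φ e)
  coprime-φ-φ d e 1≤d 1≤e d≢e with d ∣? e
  ... | no  d∤e = coprime-∣ʳ (coprime-φ-q^m−1 d e 1≤d d∤e) (φ∣q^d−1 e 1≤e)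
  ... | yes d∣e = coprime-sym (coprime-∣ʳ (coprime-φ-q^m−1 e d 1≤e λ e∣d → d≢e (ℕD.∣-antisym d∣e e∣d))
                                          (φ∣q^d−1 d 1≤d))

  φ∣qBinomial : ∀ d j → 1 ≤ j → j < d → φ d ∣ qBinomial d j
  φ∣qBinomial (suc d) (suc j) 1≤j j<d = coprime-∣-cancel
    (coprime-φ-q^m−1 (suc d) (suc j) (s≤s z≤n) λ d∣j → ℕP.<⇒≱ j<d (ℕD.∣⇒≤ d∣j))
    (φ-unitConstant (suc d) (s≤s z≤n))
    (∣ʳ-respʳ-≈ (≈-trans (≈-sym (qBinomial-absorption-q^−1 d j)) (*-comm _ _))
                (∣x⇒∣x*y (qBinomial d j) (φ∣q^d−1 (suc d) (s≤s z≤n))))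

  q^u≡-1 : ∀ u → 1 ≤ u → q ^ u ≡ - 1# mod φ (u ℕ.+ u)
  q^u≡-1 u 1≤u = ∣ʳ-respʳ-≈ (solve 2 (λ X O → X :+ O := X :- (:- O)) ≈-refl (q ^ u) 1#)
    (coprime-∣-cancel (coprime-φ-q^m−1 (u ℕ.+ u) u 1≤2u λ 2u∣u → ℕP.<⇒≱ u<2u (ℕD.∣⇒≤ {{ℕ.>-nonZero 1≤u}} 2u∣u))
                      (φ-unitConstant (u ℕ.+ u) 1≤2u)
                      (∣ʳ-respʳ-≈ q^2u−1≈q^u−1*[q^u+1] (φ∣q^d−1 (u ℕ.+ u) 1≤2u)))
    where
    1≤2u : 1 ≤ u ℕ.+ u
    1≤2u = ℕP.≤-trans 1≤u (ℕP.m≤m+n u u)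
    u<2u : u < u ℕ.+ u
    u<2u = ℕP.m<m+n u 1≤u
    q^2u−1≈q^u−1*[q^u+1] : q^ (u ℕ.+ u) −1 ≈ q^ u −1 * (q ^ u + 1#)
    q^2u−1≈q^u−1*[q^u+1] = ≈-trans (+-congʳ (^-homo-* q u u))
      (≈-sym (≈-trans (solve 2 (λ X O → (X :- O) :* (X :+ O) := X :* X :- O :* O) ≈-refl (q ^ u) 1#)
                      (+-congˡ (-‿cong (*-identityˡ 1#)))))

  -- (-1)^d q^C(d,2) ≡ -1 (mod Φ_d): for odd d since q^d ≡ 1 and d ∣ C(d,2), and for even d = 2u
  -- since q^u ≡ -1 and C(d,2) = u(d-1) with d - 1 odd.
  sign*q^C₂≡-1 : ∀ d → 1 ≤ d → sign d * q ^ C₂ d ≡ - 1# mod φ d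
  sign*q^C₂≡-1 d 1≤d with odd⊎even d 1≤d
  ... | inj₁ (e , refl) = ≡mod-trans (*-cong-mod (≈⇒≡mod sign≈-1) q^C₂≡1) (≈⇒≡mod (*-identityʳ (- 1#)))
    where
    sign≈-1 : sign (suc (e ℕ.+ e)) ≈ - 1#
    sign≈-1 = ≈-trans (*-congˡ (sign-even e)) (*-identityʳ _)
    q^C₂≡1 : q ^ C₂ (suc (e ℕ.+ e)) ≡ 1# mod φ (suc (e ℕ.+ e))
    q^C₂≡1 = ≡mod-trans
      (≈⇒≡mod (≡.subst (λ z → q ^ z ≈ (q ^ suc (e ℕ.+ e)) ^ e) (≡.sym (≡.trans (C₂-odd e) (ℕP.*-comm e _)))
                       (≈-sym (^-assocʳ q (suc (e ℕ.+ e)) e))))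
      (^-≡1-mod e (φ∣q^d−1 (suc (e ℕ.+ e)) 1≤d))
  ... | inj₂ (e , refl) = ≡mod-trans (*-cong-mod (≈⇒≡mod sign≈1) q^C₂≡-1) (≈⇒≡mod (*-identityˡ (- 1#)))
    where
    u : ℕ
    u = suc e
    2u≡d : u ℕ.+ u ≡ suc (suc (e ℕ.+ e))
    2u≡d = ≡.cong suc (ℕP.+-suc e e)
    sign≈1 : sign (suc (suc (e ℕ.+ e))) ≈ 1#
    sign≈1 = ≈-trans (*-congˡ (≈-trans (*-congˡ (sign-even e)) (*-identityʳ _))) -1*-1≈1
    q^C₂≡-1 : q ^ C₂ (suc (suc (e ℕ.+ e))) ≡ - 1# mod φ (suc (suc (e ℕ.+ e)))
    q^C₂≡-1 = ≡mod-trans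
      (≈⇒≡mod (≡.subst (λ z → q ^ z ≈ (q ^ u) ^ suc (e ℕ.+ e)) (≡.sym (C₂-even e)) (≈-sym (^-assocʳ q u (suc (e ℕ.+ e))))))
      (≡mod-trans (^-cong-mod (suc (e ℕ.+ e)) (≡.subst (λ z → q ^ u ≡ - 1# mod φ z) 2u≡d (q^u≡-1 u (s≤s z≤n))))
                  (≈⇒≡mod (≈-trans (*-congˡ (sign-even e)) (*-identityʳ _))))

  φ∣outerTerms : ∀ d → 1 ≤ d → ∀ y → y ^ d ≡ 1# mod φ d → φ d ∣ 1# + sign d * q ^ C₂ d * y ^ d
  φ∣outerTerms d 1≤d y y^d≡1 = ≡0mod⇒∣ (≡mod-trans
    (+-cong-mod (≈⇒≡mod ≈-refl) (*-cong-mod (sign*q^C₂≡-1 d 1≤d) y^d≡1))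
    (≈⇒≡mod (≈-trans (+-congˡ (*-identityʳ (- 1#))) (-‿inverseʳ 1#))))

  φ-cyclotomicLike : ∀ d → 1 ≤ d → CyclotomicLike d (φ d)
  φ-cyclotomicLike d 1≤d = record
    { q^d≡1       = φ∣q^d−1 d 1≤d
    ; ∣qBinomial  = φ∣qBinomial d
    ; ∣outerTerms = φ∣outerTerms d 1≤d }

module MainDivisibility (n c : ℕ) (r h : ℤ) (Φ : ℕ → Poly) (isCyclotomic : IsCyclotomicFamily Φ)
                        (B : ℕ → Poly) (isGaussian : IsGaussianFamily n B) where
  open LaurentPolynomials
  open GaussianBinomials ℤ[q,q⁻¹] ℤ↦ℤ[q,q⁻¹] q
  open UnitConstantsAndCoprimality
  open Decoding
  open GaussianBinomialsOverℤ[q,q⁻¹]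
  open CyclotomicValues Φ isCyclotomic

  y : Carrier
  y = pow h

  -- the value at 0 is never used
  Φ^⌊n/d⌋ : ℕ → Carrier
  Φ^⌊n/d⌋ zero    = 1#
  Φ^⌊n/d⌋ (suc i) = φ (suc i) ^ (n / suc i)

  c∣ᵇ_ : ℕ → Bool
  c∣ᵇ d = does (c ∣? d)

  theSum-decoded : fromLaurent (theSum n c r h B) ≈ multisection c r y n
  theSum-decoded = begin
    fromLaurent (theSum n c r h B)
      ≡⟨ ≡.trans (fromLaurent-sumL (map T L)) (≡.cong (foldr _+_ 0#) (≡.sym (LP.map-∘ L))) ⟩
    foldr _+_ 0# (map (λ k → fromLaurent (T k)) (filter (λ k → c ∣? ∣ + k ℤ.- r ∣) (upTo (suc n))))
      ≡⟨ ≡.cong (λ ks → foldr _+_ 0# (map (λ k → fromLaurent (T k)) (filter (λ k → c ∣? ∣ + k ℤ.- r ∣) ks)))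
                (LP.map-id (upTo (suc n))) ⟨
    foldr _+_ 0# (map (λ k → fromLaurent (T k)) (filter (λ k → c ∣? ∣ + k ℤ.- r ∣) (map (λ k → k) (upTo (suc n)))))
      ≈⟨ sum-filter-upTo (λ k → fromLaurent (T k)) (λ k → k) (λ k → c ∣? ∣ + k ℤ.- r ∣) (suc n) ⟩
    ∑ (suc n) (λ k → select (k ≡ᵇ r mod c) (fromLaurent (T k)))
      ≈⟨ ∑-cong (suc n) (λ k k<1+n → select-cong (k ≡ᵇ r mod c) (T-decoded k (ℕP.≤-pred k<1+n))) ⟩
    multisection c r y n ∎
    where
    T : ℕ → Laurent
    T k = monoL (sgn k) (+ (k C 2) ℤ.+ h ℤ.* + k) *L fromPoly (B k)
    L : List ℕ
    L = filter (λ k → c ∣? ∣ + k ℤ.- r ∣) (upTo (suc n))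
    T-decoded : ∀ k → k ≤ n → fromLaurent (T k) ≈ term n y k
    T-decoded k k≤n = begin
      fromLaurent (T k)
        ≡⟨ ≡.trans (fromLaurent-*L _ _) (≡.cong (fromLaurent (monoL (sgn k) (+ (k C 2) ℤ.+ h ℤ.* + k)) *_) (fromLaurent-fromPoly (B k))) ⟩
      fromLaurent (monoL (sgn k) (+ (k C 2) ℤ.+ h ℤ.* + k)) * poly (B k)
        ≈⟨ *-cong (fromLaurent-monoL _ _) (poly-gaussianFamily {n} {B} isGaussian k k≤n) ⟩
      ⟦ sgn k ⟧ * pow (+ (k C 2) ℤ.+ h ℤ.* + k) * qBinomial n k
        ≈⟨ *-congʳ (*-cong (⟦sgn⟧≈sign k) (≈-trans (pow-+ (+ (k C 2)) (h ℤ.* + k))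
                     (*-cong (reflexive (≡.cong (q ^_) (nC2≡C₂ k))) (pow-* h k)))) ⟩
      sign k * (q ^ C₂ k * y ^ k) * qBinomial n k
        ≈⟨ *-congʳ (*-assoc _ _ _) ⟨
      term n y k ∎

  cycProd-decoded : fromLaurent (fromPoly (cycProd Φ n c)) ≈ filteredProduct n c∣ᵇ_ Φ^⌊n/d⌋
  cycProd-decoded = begin
    fromLaurent (fromPoly (cycProd Φ n c))
      ≡⟨ ≡.trans (fromLaurent-fromPoly _) (≡.cong (λ is → poly (prodP (map G (filter (λ i → c ∣? suc i) is))))
                                                  (≡.sym (LP.map-id (upTo n)))) ⟩
    poly (prodP (map G (filter (λ i → c ∣? suc i) (map (λ i → i) (upTo n)))))
      ≈⟨ poly-prodP-filter-upTo G (λ i → i) (λ i → c ∣? suc i) n ⟩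
    ∏ n (λ i → if c∣ᵇ suc i then poly (G i) else 1#)
      ≈⟨ ∏-cong n (λ i _ → factor (c∣ᵇ suc i) i) ⟩
    filteredProduct n c∣ᵇ_ Φ^⌊n/d⌋ ∎
    where
    G : ℕ → Poly
    G i = Φ (suc i) ^P (n / suc i)
    factor : ∀ b i → (if b then poly (G i) else 1#) ≈ (if b then Φ^⌊n/d⌋ (suc i) else 1#)
    factor true  i = poly-^P (Φ (suc i)) (n / suc i)
    factor false i = ≈-refl

  ∏Φ^⌊n/d⌋∣multisection : ∀ k → k ≤ n → filteredProduct k c∣ᵇ_ Φ^⌊n/d⌋ ∣ multisection c r y n
  ∏Φ^⌊n/d⌋∣multisection zero    _   = ε∣ʳ _
  ∏Φ^⌊n/d⌋∣multisection (suc k) k<n with c ∣? suc k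
  ... | no  _   = ∣ʳ-respˡ-≈ (≈-sym (*-identityʳ _)) (∏Φ^⌊n/d⌋∣multisection k (ℕP.<⇒≤ k<n))
  ... | yes c∣d = ∣ʳ-respˡ-≈ (*-comm _ _) (coprime-∣-* coprime unitConstant new previous)
    where
    d : ℕ
    d = suc k
    previous : filteredProduct k c∣ᵇ_ Φ^⌊n/d⌋ ∣ multisection c r y n
    previous = ∏Φ^⌊n/d⌋∣multisection k (ℕP.<⇒≤ k<n)
    new : φ d ^ (n / d) ∣ multisection c r y n
    new = multisection-divisible (φ-cyclotomicLike d (s≤s z≤n)) (s≤s z≤n) c∣d (n / d) (ℕDM.m/n*n≤m n d)
            (pow^d≡1 d (φ∣q^d−1 d (s≤s z≤n)) h) r
    coprime : RationallyCoprime (φ d ^ (n / d)) (filteredProduct k c∣ᵇ_ Φ^⌊n/d⌋)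
    coprime = filteredProduct-closed (RationallyCoprime (φ d ^ (n / d))) coprime-1 coprime-*ʳ k c∣ᵇ_ Φ^⌊n/d⌋
      λ { (suc e) 1≤e e≤k _ → coprime-^ (n / d) (n / suc e)
            (coprime-φ-φ d (suc e) (s≤s z≤n) 1≤e λ d≡e → ℕP.<⇒≢ (s≤s e≤k) (≡.sym d≡e)) }
    unitConstant : HasUnitConstant (φ d ^ (n / d) * filteredProduct k c∣ᵇ_ Φ^⌊n/d⌋)
    unitConstant = unitConstant-* (unitConstant-^ (n / d) (φ-unitConstant d (s≤s z≤n)))
      (filteredProduct-closed HasUnitConstant unitConstant-1 unitConstant-* k c∣ᵇ_ Φ^⌊n/d⌋
        λ { (suc e) 1≤e _ _ → unitConstant-^ (n / suc e) (φ-unitConstant (suc e) 1≤e) })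

lemma2p2 : (n c : ℕ) → 1 ≤ n → 1 ≤ c → (r h : ℤ) →
    (Φ : ℕ → Poly) → IsCyclotomicFamily Φ →
    (B : ℕ → Poly) → IsGaussianFamily n B →
    fromPoly (cycProd Φ n c) ∣L theSum n c r h B
lemma2p2 n c _ _ r h Φ isCyclotomic B isGaussian = ∣⇒∣L _ _
  (∣ʳ-respˡ-≈ (≈-sym cycProd-decoded) (∣ʳ-respʳ-≈ (≈-sym theSum-decoded) (∏Φ^⌊n/d⌋∣multisection n ℕP.≤-refl)))
  where
  open LaurentPolynomials
  open MainDivisibility n c r h Φ isCyclotomic B isGaussian
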